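{- For every matroid $M$, with $M^\star$ its dual matroid and $\alpha$ as defined below, $$\alpha(x,y,s,M)=\alpha(y,x,s,M^\star).$$
   Context: For a matroid $M=(E,\mathcal{I})$, its dual $M^\star$ is the matroid on $E$ whose bases are the complements $E-B$ of the bases $B$ of $M$. For $A\subseteq E$, $M|A$ is the restriction to $A$ and $M/A=(M^\star\setminus A)^\star$ the contraction. $U_{0,1}$ is the one-element loop matroid, $U_{1,1}$ the one-element coloop matroid. The matroid Hopf algebra $H$ is the $\mathbb{Q}$-vector space with basis isomorphism classes of finite matroids, product direct sum, coproduct $\Delta(M)=\sum_{A\subseteq E}M|A\otimes M/A$, counit $\epsilon(M)=1$ if $E=\emptyset$ and $0$ otherwise. For linear $f,g:H\to\mathbb{Q}[x,y,s]$, $(f\ast g)(M)=\sum_{A\subseteq E}f(M|A)g(M/A)$; for an infinitesimal character $\delta$ (i.e. $\delta(M_1\oplus M_2)=\delta(M_1)\epsilon(M_2)+\epsilon(M_1)\delta(M_2)$), $\exp_\ast(\delta)=\sum_{k\ge0}\delta^{\ast k}/k!$ with $\delta^{\ast0}=\epsilon$. $\delta_{\mathrm{loop}}(M)=1$ if $M\cong U_{0,1}$, else $0$; $\delta_{\mathrm{coloop}}(M)=1$ if $M\cong U_{1,1}$, else $0$. $\alpha(x,y,s,M)=\big(\exp_\ast s\{\delta_{\mathrm{coloop}}+(y-1)\delta_{\mathrm{loop}}\}\ast\exp_\ast s\{(x-1)\delta_{\mathrm{coloop}}+\delta_{\mathrm{loop}}\}\big)(M)$. -}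

module Defs where

open import Data.Bool using (Bool; true; false; _∧_; _∨_; not; if_then_else_)
open import Data.Nat as ℕ using (ℕ; zero; suc; _!; _≡ᵇ_)
open import Data.Nat.Properties using (_!≢0)
open import Data.Integer using (+_)
open import Data.Fin using (Fin)
open import Data.Fin.Subset using (Subset; ⊤; ⊥; _∪_; _∩_; _─_; ⁅_⁆; ∣_∣; _∈_; _∉_) renaming (_-_ to _∖_)
open import Data.Vec using (Vec; []; _∷_; lookup)
open import Data.List using (List; []; _∷_; map; _++_; filter; foldr; allFin; upTo)
open import Data.Bool.ListAction using (any; all)
open import Data.Product using (Σ; _×_; _,_)
open import Relation.Binary.PropositionalEquality using (_≡_)
open import Data.Rational using (ℚ; 0ℚ; 1ℚ; _+_; _*_; _-_; _/_)

allSubsets : ∀ n → List (Subset n)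
allSubsets zero = [] ∷ []
allSubsets (suc n) = map (true ∷_) (allSubsets n) ++ map (false ∷_) (allSubsets n)

_⊆ᵇ_ : ∀ {n} → Subset n → Subset n → Bool
[] ⊆ᵇ [] = true
(a ∷ as) ⊆ᵇ (b ∷ bs) = (not a ∨ b) ∧ (as ⊆ᵇ bs)

_∈ᵇ_ : ∀ {n} → Fin n → Subset n → Bool
i ∈ᵇ A = lookup A i

record Matroid (n : ℕ) : Set where
  field
    isBasis  : Subset n → Bool
    nonempty : Σ (Subset n) λ B → isBasis B ≡ true
    exchange : ∀ B₁ B₂ → isBasis B₁ ≡ true → isBasis B₂ ≡ true →
               ∀ x → x ∈ B₁ → x ∉ B₂ →
               Σ (Fin n) λ y → y ∈ B₂ × y ∉ B₁ × isBasis ((B₁ ∖ x) ∪ ⁅ y ⁆) ≡ true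

-- Set systems (ground set E ⊆ Fin n, family of bases), used to
-- represent matroids on arbitrary subsets E of the universe Fin n,
-- so that minors M|A and M/A can be formed without relabelling.

record SetSys (n : ℕ) : Set where
  field
    ground  : Subset n
    isBasis : Subset n → Bool
open SetSys public

toSys : ∀ {n} → Matroid n → SetSys n
toSys {n} M = record { ground = ⊤ ; isBasis = Matroid.isBasis M }

indep : ∀ {n} → SetSys n → Subset n → Bool
indep {n} M I = any (λ B → isBasis M B ∧ (I ⊆ᵇ B)) (allSubsets n)

dual : ∀ {n} → SetSys n → SetSys n
dual M = record
  { ground  = ground M
  ; isBasis = λ X → (X ⊆ᵇ ground M) ∧ isBasis M (ground M ─ X) }

restrict : ∀ {n} → SetSys n → Subset n → SetSys n
restrict {n} M A = record
  { ground  = A' 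
  ; isBasis = λ X → (X ⊆ᵇ A') ∧ indep M X ∧
      all (λ e → not (e ∈ᵇ A') ∨ (e ∈ᵇ X) ∨ not (indep M (X ∪ ⁅ e ⁆))) (allFin n) }
  where A' = A ∩ ground M

contract : ∀ {n} → SetSys n → Subset n → SetSys n
contract M A = dual (restrict (dual M) (ground M ─ A))

-- Linear maps H → ℚ (evaluated on matroids) and convolution.

Fun : ℕ → Set
Fun n = SetSys n → ℚ

sumℚ : List ℚ → ℚ
sumℚ = foldr _+_ 0ℚ

_⊛_ : ∀ {n} → Fun n → Fun n → Fun n
(f ⊛ g) M = sumℚ (map (λ A → f (restrict M A) * g (contract M A))
                      (filter (λ A → Data.Bool.T? (A ⊆ᵇ ground M)) (allSubsets _)))
  where import Data.Bool

counit : ∀ {n} → Fun n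
counit M = if ∣ ground M ∣ ≡ᵇ 0 then 1ℚ else 0ℚ

δloop : ∀ {n} → Fun n
δloop M = if (∣ ground M ∣ ≡ᵇ 1) ∧ isBasis M ⊥ ∧ not (isBasis M (ground M))
          then 1ℚ else 0ℚ

δcoloop : ∀ {n} → Fun n
δcoloop M = if (∣ ground M ∣ ≡ᵇ 1) ∧ not (isBasis M ⊥) ∧ isBasis M (ground M)
            then 1ℚ else 0ℚ

convPow : ∀ {n} → Fun n → ℕ → Fun n
convPow δ zero = counit
convPow δ (suc k) = convPow δ k ⊛ δ

-- exp_∗(δ) = Σ_k δ^{∗k}/k!.  For an infinitesimal character δ (δ(∅) = 0)
-- δ^{∗k}(M) = 0 as soon as k > |E|, and |E| ≤ n, so the series is the
-- finite sum over k = 0 … n.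
inv! : ℕ → ℚ
inv! k = (+ 1 / (k !)) {{k !≢0}}

expStar : ∀ {n} → Fun n → Fun n
expStar {n} δ M = sumℚ (map (λ k → inv! k * convPow δ k M) (upTo (suc n)))

α : ∀ {n} → ℚ → ℚ → ℚ → SetSys n → ℚ
α x y s = expStar (λ N → s * (δcoloop N + (y - 1ℚ) * δloop N))
        ⊛ expStar (λ N → s * ((x - 1ℚ) * δcoloop N + δloop N))

{-# OPTIONS --safe #-}
-- A set system N on a ground set E ⊆ Fin n is described by a rank function ρ: ρ satisfies the rank
-- axioms on E, and the bases of N are exactly the X ⊆ E with ρ X = ∣ X ∣ = ρ E. Such a description
-- passes to restrictions (same ρ), to the dual (ρ* X = ∣ X ∣ + ρ (E ─ X) − ρ E) and hence to
-- contractions, and a matroid given by its bases has the rank function X ↦ max_B ∣ X ∩ B ∣.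
--
-- For δ = a·δcoloop + b·δloop, only the A with ∣ E ─ A ∣ = 1 survive in
-- δ^{∗(k+1)}(N) = Σ_A δ^{∗k}(N|A) δ(N/A), and N/A is then a coloop or a loop according as
-- ρ E − ρ A is 1 or 0. By induction δ^{∗k}(N) = k!·a^{ρ E} b^{∣E∣ − ρ E} if k = ∣ E ∣ and 0 otherwise,
-- so exp∗(δ)(N) = a^{ρ E} b^{∣E∣ − ρ E}. Hence
--   α(x,y,s,M) = Σ_{A ⊆ E} s^{r A} (s(y−1))^{∣A∣ − r A} (s(x−1))^{r E − r A} s^{∣E ─ A∣ − (r E − r A)},
-- and replacing A by E ─ A and r by its dual r* merely permutes the four exponents.
module Submission where

open import Defs
open import Data.Nat using (ℕ)
open import Data.Rational using (ℚ)
open import Relation.Binary.PropositionalEquality using (_≡_)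

open import Data.Bool using (if_then_else_)
open import Data.Fin.Subset using (⊤; _─_; ∁)
open import Data.Fin.Subset.Properties using (⊆⊤)
open import Data.Rational using (0ℚ)
open import Function using (_∘_)
open import Relation.Binary.PropositionalEquality using (sym; cong; module ≡-Reasoning)

module RankFunctions where

  open import Data.Bool using (Bool; true; false; T; T?; not; _∧_; _∨_)
  open import Data.Bool.Properties using (T-≡; T-∧; ∧-zeroʳ; ∧-identityʳ; ∧-idem; ∨-identityʳ; ∨-idem)
  open import Data.Fin using (Fin; zero; suc)
  open import Data.Fin.Properties using (any?)
  open import Data.Fin.Subset
  open import Data.Fin.Subset.Properties
  open import Data.List using (allFin; map; _++_; filter)
  open import Data.List.Extrema.Nat using (argmax; argmax-all; f[xs]≤f[argmax])
  open import Data.List.Membership.Propositional using () renaming (_∈_ to _∈ₗ_)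
  open import Data.List.Membership.Propositional.Properties using (∈-allFin; ∈-map⁺; ∈-++⁺ˡ; ∈-++⁺ʳ; ∈-filter⁺)
  import Data.List.Relation.Unary.All as All
  open import Data.List.Relation.Unary.All.Properties using (all⁺; all⁻; all-filter)
  import Data.List.Relation.Unary.Any as Any
  open import Data.List.Relation.Unary.Any using (satisfied) renaming (here to hereₗ)
  open import Data.List.Relation.Unary.Any.Properties using (any⁺; any⁻)
  open import Data.Nat using (ℕ; zero; suc; _+_; _∸_; _≤_; _<_; _≟_; s≤s⁻¹)
  open import Data.Nat.Properties
  open import Data.Nat.Tactic.RingSolver using (solve-∀)
  open import Algebra.Properties.CommutativeSemigroup +-commutativeSemigroup using (interchange)
  open import Data.Product using (∃-syntax; _×_; _,_; proj₁; proj₂)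
  open import Data.Sum using (inj₁; inj₂)
  open import Data.Vec using ([]; _∷_; here; there)
  open import Data.Vec.Properties using ([]=⇒lookup; lookup⇒[]=)
  open import Function using (_∘_; id; _⇔_; mk⇔; Equivalence)
  open import Relation.Binary.PropositionalEquality
  open import Relation.Nullary using (¬_; yes; no)
  open import Relation.Nullary.Decidable using (_×-dec_; ¬?)
  open import Relation.Nullary.Negation using (contradiction)

  open Equivalence using (to; from)
  open ≤-Reasoning

  private variable
    n : ℕ
    x e : Fin n
    p q r A B I X Y : Subset n
    N : SetSys n

  [m+n]∸[o+p]≡[m∸o]+[n∸p] : ∀ {m n o p} → o ≤ m → p ≤ n → (m + n) ∸ (o + p) ≡ (m ∸ o) + (n ∸ p)
  [m+n]∸[o+p]≡[m∸o]+[n∸p] {o = o} {p} o≤m p≤n with m≤n⇒∃[o]m+o≡n o≤m | m≤n⇒∃[o]m+o≡n p≤n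
  ... | i , refl | j , refl = begin-equality
    (o + i + (p + j)) ∸ (o + p)   ≡⟨ cong (_∸ (o + p)) (interchange o i p j) ⟩
    (o + p + (i + j)) ∸ (o + p)   ≡⟨ m+n∸m≡n (o + p) (i + j) ⟩
    i + j                         ≡⟨ sym (cong₂ _+_ (m+n∸m≡n o i) (m+n∸m≡n p j)) ⟩
    (o + i ∸ o) + (p + j ∸ p)     ∎

  x∈p─q⇒x∉q : ∀ (p q : Subset n) → x ∈ p ─ q → x ∉ q
  x∈p─q⇒x∉q (_ ∷ p) (_ ∷ q) (there x∈p─q) (there x∈q) = x∈p─q⇒x∉q p q x∈p─q x∈q

  ∪-⊆ : p ⊆ r → q ⊆ r → p ∪ q ⊆ r
  ∪-⊆ {p = p} {q = q} p⊆r q⊆r x∈p∪q with x∈p∪q⁻ p q x∈p∪q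
  ... | inj₁ x∈p = p⊆r x∈p
  ... | inj₂ x∈q = q⊆r x∈q

  x∈p⇒⁅x⁆⊆p : x ∈ p → ⁅ x ⁆ ⊆ p
  x∈p⇒⁅x⁆⊆p {x = x} x∈p y∈⁅x⁆ rewrite x∈⁅y⁆⇒x≡y x y∈⁅x⁆ = x∈p

  p⊆q⇒q∩p≡p : p ⊆ q → q ∩ p ≡ p
  p⊆q⇒q∩p≡p {p = []}          {[]}    _   = refl
  p⊆q⇒q∩p≡p {p = outside ∷ _} {t ∷ _} p⊆q = cong₂ _∷_ (∧-zeroʳ t) (p⊆q⇒q∩p≡p (drop-∷-⊆ p⊆q))
  p⊆q⇒q∩p≡p {p = inside ∷ _}  {t ∷ _} p⊆q with p⊆q here
  ... | here = cong (inside ∷_) (p⊆q⇒q∩p≡p (drop-∷-⊆ p⊆q))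

  p⊆q⇒p∩q≡p : p ⊆ q → p ∩ q ≡ p
  p⊆q⇒p∩q≡p {p = p} {q = q} p⊆q = trans (∩-comm p q) (p⊆q⇒q∩p≡p p⊆q)

  p⊆q⇒p∪[q─p]≡q : p ⊆ q → p ∪ (q ─ p) ≡ q
  p⊆q⇒p∪[q─p]≡q {p = []}          {[]}    _   = refl
  p⊆q⇒p∪[q─p]≡q {p = outside ∷ _} {t ∷ _} p⊆q = cong (t ∷_) (p⊆q⇒p∪[q─p]≡q (drop-∷-⊆ p⊆q))
  p⊆q⇒p∪[q─p]≡q {p = inside ∷ _}  {t ∷ _} p⊆q with p⊆q here
  ... | here = cong (inside ∷_) (p⊆q⇒p∪[q─p]≡q (drop-∷-⊆ p⊆q))

  p⊆q⇒q─[q─p]≡p : p ⊆ q → q ─ (q ─ p) ≡ p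
  p⊆q⇒q─[q─p]≡p {p = []}          {[]}          _   = refl
  p⊆q⇒q─[q─p]≡p {p = outside ∷ _} {inside ∷ _}  p⊆q = cong (outside ∷_) (p⊆q⇒q─[q─p]≡p (drop-∷-⊆ p⊆q))
  p⊆q⇒q─[q─p]≡p {p = outside ∷ _} {outside ∷ _} p⊆q = cong (outside ∷_) (p⊆q⇒q─[q─p]≡p (drop-∷-⊆ p⊆q))
  p⊆q⇒q─[q─p]≡p {p = inside ∷ _}  {t ∷ _}       p⊆q with p⊆q here
  ... | here = cong (inside ∷_) (p⊆q⇒q─[q─p]≡p (drop-∷-⊆ p⊆q))

  p⊆q⊆r⇒[r─q]∪[q─p]≡r─p : p ⊆ q → q ⊆ r → (r ─ q) ∪ (q ─ p) ≡ r ─ p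
  p⊆q⊆r⇒[r─q]∪[q─p]≡r─p {p = []} {[]} {[]} _ _ = refl
  p⊆q⊆r⇒[r─q]∪[q─p]≡r─p {p = s ∷ _} {inside ∷ _} {u ∷ _} p⊆q q⊆r with q⊆r here
  p⊆q⊆r⇒[r─q]∪[q─p]≡r─p {p = inside ∷ _}  {inside ∷ _} {u ∷ _} p⊆q q⊆r | here =
    cong (outside ∷_) (p⊆q⊆r⇒[r─q]∪[q─p]≡r─p (drop-∷-⊆ p⊆q) (drop-∷-⊆ q⊆r))
  p⊆q⊆r⇒[r─q]∪[q─p]≡r─p {p = outside ∷ _} {inside ∷ _} {u ∷ _} p⊆q q⊆r | here =
    cong (inside ∷_) (p⊆q⊆r⇒[r─q]∪[q─p]≡r─p (drop-∷-⊆ p⊆q) (drop-∷-⊆ q⊆r))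
  p⊆q⊆r⇒[r─q]∪[q─p]≡r─p {p = inside ∷ _} {outside ∷ _} p⊆q _ with p⊆q here
  ... | ()
  p⊆q⊆r⇒[r─q]∪[q─p]≡r─p {p = outside ∷ _} {outside ∷ _} {u ∷ _} p⊆q q⊆r =
    cong₂ _∷_ (∨-identityʳ u) (p⊆q⊆r⇒[r─q]∪[q─p]≡r─p (drop-∷-⊆ p⊆q) (drop-∷-⊆ q⊆r))

  [p─q]∩p≡p─q : ∀ (p q : Subset n) → (p ─ q) ∩ p ≡ p ─ q
  [p─q]∩p≡p─q []           []           = refl
  [p─q]∩p≡p─q (_ ∷ p)      (inside ∷ q)  = cong (outside ∷_) ([p─q]∩p≡p─q p q)
  [p─q]∩p≡p─q (inside ∷ p) (outside ∷ q) = cong (inside ∷_) ([p─q]∩p≡p─q p q)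
  [p─q]∩p≡p─q (outside ∷ p) (outside ∷ q) = cong (outside ∷_) ([p─q]∩p≡p─q p q)

  p─p≡⊥ : ∀ (p : Subset n) → p ─ p ≡ ⊥
  p─p≡⊥ []           = refl
  p─p≡⊥ (inside ∷ p)  = cong (outside ∷_) (p─p≡⊥ p)
  p─p≡⊥ (outside ∷ p) = cong (outside ∷_) (p─p≡⊥ p)

  r─[p∪q]≡[r─p]∩[r─q] : ∀ (r p q : Subset n) → r ─ (p ∪ q) ≡ (r ─ p) ∩ (r ─ q)
  r─[p∪q]≡[r─p]∩[r─q] []      []           []            = refl
  r─[p∪q]≡[r─p]∩[r─q] (_ ∷ r) (inside ∷ p)  (_ ∷ q)       = cong (outside ∷_) (r─[p∪q]≡[r─p]∩[r─q] r p q)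
  r─[p∪q]≡[r─p]∩[r─q] (u ∷ r) (outside ∷ p) (inside ∷ q)  = cong₂ _∷_ (sym (∧-zeroʳ u)) (r─[p∪q]≡[r─p]∩[r─q] r p q)
  r─[p∪q]≡[r─p]∩[r─q] (u ∷ r) (outside ∷ p) (outside ∷ q) = cong₂ _∷_ (sym (∧-idem u)) (r─[p∪q]≡[r─p]∩[r─q] r p q)

  r─[p∩q]≡[r─p]∪[r─q] : ∀ (r p q : Subset n) → r ─ (p ∩ q) ≡ (r ─ p) ∪ (r ─ q)
  r─[p∩q]≡[r─p]∪[r─q] []      []           []            = refl
  r─[p∩q]≡[r─p]∪[r─q] (_ ∷ r) (inside ∷ p)  (inside ∷ q)  = cong (outside ∷_) (r─[p∩q]≡[r─p]∪[r─q] r p q)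
  r─[p∩q]≡[r─p]∪[r─q] (u ∷ r) (inside ∷ p)  (outside ∷ q) = cong (u ∷_) (r─[p∩q]≡[r─p]∪[r─q] r p q)
  r─[p∩q]≡[r─p]∪[r─q] (u ∷ r) (outside ∷ p) (inside ∷ q)  = cong₂ _∷_ (sym (∨-identityʳ u)) (r─[p∩q]≡[r─p]∪[r─q] r p q)
  r─[p∩q]≡[r─p]∪[r─q] (u ∷ r) (outside ∷ p) (outside ∷ q) = cong₂ _∷_ (sym (∨-idem u)) (r─[p∩q]≡[r─p]∪[r─q] r p q)

  r∪[p∪q]≡[r∪p]∪[r∪q] : ∀ (r p q : Subset n) → r ∪ (p ∪ q) ≡ (r ∪ p) ∪ (r ∪ q)
  r∪[p∪q]≡[r∪p]∪[r∪q] []           []      []      = refl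
  r∪[p∪q]≡[r∪p]∪[r∪q] (inside ∷ r)  (_ ∷ p) (_ ∷ q) = cong (inside ∷_) (r∪[p∪q]≡[r∪p]∪[r∪q] r p q)
  r∪[p∪q]≡[r∪p]∪[r∪q] (outside ∷ r) (s ∷ p) (t ∷ q) = cong ((s ∨ t) ∷_) (r∪[p∪q]≡[r∪p]∪[r∪q] r p q)

  x∈p⇒[p-x]∪⁅x⁆≡p : x ∈ p → (p - x) ∪ ⁅ x ⁆ ≡ p
  x∈p⇒[p-x]∪⁅x⁆≡p {x = zero}  {p = inside ∷ p} here = cong (inside ∷_) (trans (∪-identityʳ (p ─ ⊥)) (p─⊥≡p p))
  x∈p⇒[p-x]∪⁅x⁆≡p {x = suc x} {p = s ∷ p} (there x∈p) = cong₂ _∷_ (∨-identityʳ s) (x∈p⇒[p-x]∪⁅x⁆≡p x∈p)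

  ⊤─p≡∁p : ∀ (p : Subset n) → ⊤ ─ p ≡ ∁ p
  ⊤─p≡∁p []           = refl
  ⊤─p≡∁p (inside ∷ p)  = cong (outside ∷_) (⊤─p≡∁p p)
  ⊤─p≡∁p (outside ∷ p) = cong (inside ∷_) (⊤─p≡∁p p)

  ∣p∣≡∣p∩q∣+∣p─q∣ : ∀ (p q : Subset n) → ∣ p ∣ ≡ ∣ p ∩ q ∣ + ∣ p ─ q ∣
  ∣p∣≡∣p∩q∣+∣p─q∣ []            []            = refl
  ∣p∣≡∣p∩q∣+∣p─q∣ (inside ∷ p)  (inside ∷ q)  = cong suc (∣p∣≡∣p∩q∣+∣p─q∣ p q)
  ∣p∣≡∣p∩q∣+∣p─q∣ (inside ∷ p)  (outside ∷ q) = trans (cong suc (∣p∣≡∣p∩q∣+∣p─q∣ p q)) (sym (+-suc _ _))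
  ∣p∣≡∣p∩q∣+∣p─q∣ (outside ∷ p) (inside ∷ q)  = ∣p∣≡∣p∩q∣+∣p─q∣ p q
  ∣p∣≡∣p∩q∣+∣p─q∣ (outside ∷ p) (outside ∷ q) = ∣p∣≡∣p∩q∣+∣p─q∣ p q

  p⊆q⇒∣q∣≡∣p∣+∣q─p∣ : p ⊆ q → ∣ q ∣ ≡ ∣ p ∣ + ∣ q ─ p ∣
  p⊆q⇒∣q∣≡∣p∣+∣q─p∣ {p = p} {q = q} p⊆q =
    trans (∣p∣≡∣p∩q∣+∣p─q∣ q p) (cong (λ s → ∣ s ∣ + ∣ q ─ p ∣) (p⊆q⇒q∩p≡p p⊆q))

  ∣p∪q∣+∣p∩q∣≡∣p∣+∣q∣ : ∀ (p q : Subset n) → ∣ p ∪ q ∣ + ∣ p ∩ q ∣ ≡ ∣ p ∣ + ∣ q ∣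
  ∣p∪q∣+∣p∩q∣≡∣p∣+∣q∣ []            []            = refl
  ∣p∪q∣+∣p∩q∣≡∣p∣+∣q∣ (inside ∷ p)  (inside ∷ q)  =
    cong suc (trans (+-suc _ _) (trans (cong suc (∣p∪q∣+∣p∩q∣≡∣p∣+∣q∣ p q)) (sym (+-suc _ _))))
  ∣p∪q∣+∣p∩q∣≡∣p∣+∣q∣ (inside ∷ p)  (outside ∷ q) = cong suc (∣p∪q∣+∣p∩q∣≡∣p∣+∣q∣ p q)
  ∣p∪q∣+∣p∩q∣≡∣p∣+∣q∣ (outside ∷ p) (inside ∷ q)  =
    trans (cong suc (∣p∪q∣+∣p∩q∣≡∣p∣+∣q∣ p q)) (sym (+-suc _ _))
  ∣p∪q∣+∣p∩q∣≡∣p∣+∣q∣ (outside ∷ p) (outside ∷ q) = ∣p∪q∣+∣p∩q∣≡∣p∣+∣q∣ p q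

  x∉p⇒∣p∪⁅x⁆∣≡1+∣p∣ : ∀ (p : Subset n) → x ∉ p → ∣ p ∪ ⁅ x ⁆ ∣ ≡ suc ∣ p ∣
  x∉p⇒∣p∪⁅x⁆∣≡1+∣p∣ {x = zero}  (inside ∷ p)  x∉p = contradiction here x∉p
  x∉p⇒∣p∪⁅x⁆∣≡1+∣p∣ {x = zero}  (outside ∷ p) _   = cong (suc ∘ ∣_∣) (∪-identityʳ p)
  x∉p⇒∣p∪⁅x⁆∣≡1+∣p∣ {x = suc x} (inside ∷ p)  x∉p = cong suc (x∉p⇒∣p∪⁅x⁆∣≡1+∣p∣ p (x∉p ∘ there))
  x∉p⇒∣p∪⁅x⁆∣≡1+∣p∣ {x = suc x} (outside ∷ p) x∉p = x∉p⇒∣p∪⁅x⁆∣≡1+∣p∣ p (x∉p ∘ there)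

  x∈p⇒∣p∣≡1+∣p-x∣ : x ∈ p → ∣ p ∣ ≡ suc ∣ p - x ∣
  x∈p⇒∣p∣≡1+∣p-x∣ {x = x} {p = p} x∈p = trans (p⊆q⇒∣q∣≡∣p∣+∣q─p∣ (x∈p⇒⁅x⁆⊆p x∈p)) (cong (_+ ∣ p - x ∣) (∣⁅x⁆∣≡1 x))

  x∈q⇒[p∪⁅x⁆]─q≡p─q : ∀ (p q : Subset n) → x ∈ q → (p ∪ ⁅ x ⁆) ─ q ≡ p ─ q
  x∈q⇒[p∪⁅x⁆]─q≡p─q {x = zero}  (s ∷ p) (inside ∷ q) here        = cong (outside ∷_) (cong (_─ q) (∪-identityʳ p))
  x∈q⇒[p∪⁅x⁆]─q≡p─q {x = suc x} (s ∷ p) (inside ∷ q)  (there x∈q) = cong (outside ∷_) (x∈q⇒[p∪⁅x⁆]─q≡p─q p q x∈q)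
  x∈q⇒[p∪⁅x⁆]─q≡p─q {x = suc x} (s ∷ p) (outside ∷ q) (there x∈q) =
    cong₂ _∷_ (∨-identityʳ s) (x∈q⇒[p∪⁅x⁆]─q≡p─q p q x∈q)

  [p∩q]∩r≡[p∩r]∩[q∩r] : ∀ (p q r : Subset n) → (p ∩ q) ∩ r ≡ (p ∩ r) ∩ (q ∩ r)
  [p∩q]∩r≡[p∩r]∩[q∩r] []      []      []            = refl
  [p∩q]∩r≡[p∩r]∩[q∩r] (s ∷ p) (t ∷ q) (inside ∷ r)  =
    cong₂ _∷_ (trans (∧-identityʳ _) (sym (cong₂ _∧_ (∧-identityʳ s) (∧-identityʳ t)))) ([p∩q]∩r≡[p∩r]∩[q∩r] p q r)
  [p∩q]∩r≡[p∩r]∩[q∩r] (s ∷ p) (t ∷ q) (outside ∷ r) =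
    cong₂ _∷_ (trans (∧-zeroʳ _) (sym (cong (_∧ _) (∧-zeroʳ s)))) ([p∩q]∩r≡[p∩r]∩[q∩r] p q r)

  p⊆q∧∣q∣≤∣p∣⇒p≡q : p ⊆ q → ∣ q ∣ ≤ ∣ p ∣ → p ≡ q
  p⊆q∧∣q∣≤∣p∣⇒p≡q {p = p} {q = q} p⊆q ∣q∣≤∣p∣ = ⊆-antisym p⊆q q⊆p
    where
    q⊆p : q ⊆ p
    q⊆p {x} x∈q with x ∈? p
    ... | yes x∈p = x∈p
    ... | no  x∉p = contradiction (p⊂q⇒∣p∣<∣q∣ (p⊆q , x , x∈q , x∉p)) (≤⇒≯ ∣q∣≤∣p∣)

  ⊆ᵇ⇒⊆ : ∀ (p q : Subset n) → T (p ⊆ᵇ q) → p ⊆ q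
  ⊆ᵇ⇒⊆ (inside ∷ p)  (inside ∷ q) p⊆ᵇq here        = here
  ⊆ᵇ⇒⊆ (inside ∷ p)  (inside ∷ q) p⊆ᵇq (there x∈p) = there (⊆ᵇ⇒⊆ p q p⊆ᵇq x∈p)
  ⊆ᵇ⇒⊆ (outside ∷ p) (inside ∷ q) p⊆ᵇq (there x∈p) = there (⊆ᵇ⇒⊆ p q p⊆ᵇq x∈p)
  ⊆ᵇ⇒⊆ (outside ∷ p) (outside ∷ q) p⊆ᵇq (there x∈p) = there (⊆ᵇ⇒⊆ p q p⊆ᵇq x∈p)

  ⊆⇒⊆ᵇ : ∀ (p q : Subset n) → p ⊆ q → T (p ⊆ᵇ q)
  ⊆⇒⊆ᵇ []            []            _   = _
  ⊆⇒⊆ᵇ (inside ∷ p)  (inside ∷ q)  p⊆q = ⊆⇒⊆ᵇ p q (drop-∷-⊆ p⊆q)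
  ⊆⇒⊆ᵇ (outside ∷ p) (inside ∷ q)  p⊆q = ⊆⇒⊆ᵇ p q (drop-∷-⊆ p⊆q)
  ⊆⇒⊆ᵇ (outside ∷ p) (outside ∷ q) p⊆q = ⊆⇒⊆ᵇ p q (drop-∷-⊆ p⊆q)
  ⊆⇒⊆ᵇ (inside ∷ p)  (outside ∷ q) p⊆q with p⊆q here
  ... | ()

  ∈ᵇ⇔∈ : T (x ∈ᵇ p) ⇔ x ∈ p
  ∈ᵇ⇔∈ {x = x} {p = p} = mk⇔ (lookup⇒[]= x p ∘ to T-≡) (from T-≡ ∘ []=⇒lookup)

  ∈-allSubsets : ∀ (p : Subset n) → p ∈ₗ allSubsets n
  ∈-allSubsets []            = hereₗ refl
  ∈-allSubsets (inside ∷ p)  = ∈-++⁺ˡ (∈-map⁺ (inside ∷_) (∈-allSubsets p))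
  ∈-allSubsets (outside ∷ p) = ∈-++⁺ʳ (map (inside ∷_) (allSubsets _)) (∈-map⁺ (outside ∷_) (∈-allSubsets p))

  T-not∨∨not : ∀ a b c → T (not a ∨ b ∨ not c) ⇔ (T a → ¬ T b → ¬ T c)
  T-not∨∨not false _     _     = mk⇔ (λ _ ()) (λ _ → _)
  T-not∨∨not true  true  _     = mk⇔ (λ _ _ ¬b → contradiction _ ¬b) (λ _ → _)
  T-not∨∨not true  false false = mk⇔ (λ _ _ _ ()) (λ _ → _)
  T-not∨∨not true  false true  = mk⇔ (λ ()) (λ h → h _ id _)

  Basis : SetSys n → Subset n → Set
  Basis N B = T (isBasis N B)

  Indep : SetSys n → Subset n → Set
  Indep N I = T (indep N I)

  indep⇒⊆basis : ∀ N → Indep N I → ∃[ B ] Basis N B × I ⊆ B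
  indep⇒⊆basis {I = I} N indepI with satisfied (any⁻ _ (allSubsets _) indepI)
  ... | B , basis∧I⊆ᵇB with to T-∧ basis∧I⊆ᵇB
  ...   | basisB , I⊆ᵇB = B , basisB , ⊆ᵇ⇒⊆ I B I⊆ᵇB

  ⊆basis⇒indep : ∀ N → Basis N B → I ⊆ B → Indep N I
  ⊆basis⇒indep {B = B} {I = I} N basisB I⊆B =
    any⁺ _ (Any.map (λ { refl → from T-∧ (basisB , ⊆⇒⊆ᵇ I B I⊆B) }) (∈-allSubsets B))

  dual-basis⁻ : Basis (dual N) X → X ⊆ ground N × Basis N (ground N ─ X)
  dual-basis⁻ {N = N} {X = X} b = let X⊆ᵇG , basis = to T-∧ b in ⊆ᵇ⇒⊆ X (ground N) X⊆ᵇG , basis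

  dual-basis⁺ : X ⊆ ground N → Basis N (ground N ─ X) → Basis (dual N) X
  dual-basis⁺ {X = X} {N = N} X⊆G basis = from T-∧ (⊆⇒⊆ᵇ X (ground N) X⊆G , basis)

  module _ {N : SetSys n} {A X : Subset n} where

    private
      A′ = A ∩ ground N
      Maximal = ∀ {e} → e ∈ A′ → e ∉ X → ¬ Indep N (X ∪ ⁅ e ⁆)
      test : Fin n → Bool
      test e = not (e ∈ᵇ A′) ∨ (e ∈ᵇ X) ∨ not (indep N (X ∪ ⁅ e ⁆))

    restrict-basis⁻ : Basis (restrict N A) X → X ⊆ A′ × Indep N X × Maximal
    restrict-basis⁻ b =
      let X⊆ᵇA′ , rest = to (T-∧ {X ⊆ᵇ A′}) b
          indepX , maximalᵇ = to (T-∧ {indep N X}) rest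
      in ⊆ᵇ⇒⊆ X A′ X⊆ᵇA′ , indepX , λ {e} → maximal e (All.lookup (all⁺ test _ maximalᵇ) (∈-allFin e))
      where
      maximal : ∀ e → T (test e) → e ∈ A′ → e ∉ X → ¬ Indep N (X ∪ ⁅ e ⁆)
      maximal e t e∈A′ e∉X = to (T-not∨∨not _ _ _) t (from ∈ᵇ⇔∈ e∈A′) (e∉X ∘ to ∈ᵇ⇔∈)

    restrict-basis⁺ : X ⊆ A′ → Indep N X → Maximal → Basis (restrict N A) X
    restrict-basis⁺ X⊆A′ indepX maximal =
      from T-∧ (⊆⇒⊆ᵇ X A′ X⊆A′ , from T-∧ (indepX , all⁻ test {allFin n} (All.tabulate (λ {e} _ → maximalᵇ e))))
      where
      maximalᵇ : ∀ e → T (test e)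
      maximalᵇ e = from (T-not∨∨not _ _ _) (λ e∈A′ e∈ᵇX → maximal (to ∈ᵇ⇔∈ e∈A′) (e∈ᵇX ∘ from ∈ᵇ⇔∈))

  -- Rank functions

  record RankAxioms (E : Subset n) (ρ : Subset n → ℕ) : Set where
    field
      bounded    : X ⊆ E → ρ X ≤ ∣ X ∣
      monotone   : X ⊆ Y → Y ⊆ E → ρ X ≤ ρ Y
      submodular : X ⊆ E → Y ⊆ E → ρ (X ∪ Y) + ρ (X ∩ Y) ≤ ρ X + ρ Y

  RankAxioms-⊆ : ∀ {E F : Subset n} {ρ} → F ⊆ E → RankAxioms E ρ → RankAxioms F ρ
  RankAxioms-⊆ F⊆E ax = record
    { bounded    = λ X⊆F → bounded (F⊆E ∘ X⊆F)
    ; monotone   = λ X⊆Y Y⊆F → monotone X⊆Y (F⊆E ∘ Y⊆F)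
    ; submodular = λ X⊆F Y⊆F → submodular (F⊆E ∘ X⊆F) (F⊆E ∘ Y⊆F)
    } where open RankAxioms ax

  module RankAxiomsProperties {E : Subset n} {ρ : Subset n → ℕ} (ax : RankAxioms E ρ) where

    open RankAxioms ax

    ρ⊥≡0 : ρ ⊥ ≡ 0
    ρ⊥≡0 = n≤0⇒n≡0 (subst (ρ ⊥ ≤_) (∣⊥∣≡0 n) (bounded ⊥⊆))

    subadditive : X ⊆ E → A ⊆ E → ρ (X ∪ A) ≤ ρ X + ∣ A ∣
    subadditive {X = X} {A = A} X⊆E A⊆E = begin
      ρ (X ∪ A)             ≤⟨ m≤m+n _ _ ⟩
      ρ (X ∪ A) + ρ (X ∩ A) ≤⟨ submodular X⊆E A⊆E ⟩
      ρ X + ρ A             ≤⟨ +-monoʳ-≤ (ρ X) (bounded A⊆E) ⟩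
      ρ X + ∣ A ∣           ∎

    ρB∸ρA≤∣B─A∣ : A ⊆ B → B ⊆ E → ρ B ∸ ρ A ≤ ∣ B ─ A ∣
    ρB∸ρA≤∣B─A∣ {A = A} {B = B} A⊆B B⊆E = m≤n+o⇒m∸n≤o (ρ B) (ρ A)
      (subst (λ S → ρ S ≤ ρ A + ∣ B ─ A ∣) (p⊆q⇒p∪[q─p]≡q A⊆B) (subadditive (B⊆E ∘ A⊆B) (B⊆E ∘ p─q⊆p B A)))

    ρ-∪⁅⁆≡ : X ⊆ E → e ∈ E → ρ (X ∪ ⁅ e ⁆) ≢ suc (ρ X) → ρ (X ∪ ⁅ e ⁆) ≡ ρ X
    ρ-∪⁅⁆≡ {X = X} {e = e} X⊆E e∈E ≢suc = ≤-antisym (s≤s⁻¹ (≤∧≢⇒< ≤suc ≢suc)) ρX≤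
      where
      ρX≤ : ρ X ≤ ρ (X ∪ ⁅ e ⁆)
      ρX≤ = monotone (p⊆p∪q _) (∪-⊆ X⊆E (x∈p⇒⁅x⁆⊆p e∈E))
      ≤suc : ρ (X ∪ ⁅ e ⁆) ≤ suc (ρ X)
      ≤suc = subst (ρ (X ∪ ⁅ e ⁆) ≤_) (trans (cong (ρ X +_) (∣⁅x⁆∣≡1 e)) (+-comm (ρ X) 1))
                   (subadditive X⊆E (x∈p⇒⁅x⁆⊆p e∈E))

    ρ-∪⁅⁆≡∣∣ : e ∉ X → ρ X ≡ ∣ X ∣ → ρ (X ∪ ⁅ e ⁆) ≡ suc (ρ X) → ρ (X ∪ ⁅ e ⁆) ≡ ∣ X ∪ ⁅ e ⁆ ∣
    ρ-∪⁅⁆≡∣∣ {X = X} e∉X ρX≡∣X∣ ρ[X∪⁅e⁆]≡ = trans ρ[X∪⁅e⁆]≡ (trans (cong suc ρX≡∣X∣) (sym (x∉p⇒∣p∪⁅x⁆∣≡1+∣p∣ X e∉X)))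

    ρ-∪-≡ : X ⊆ A → X ⊆ B → A ⊆ E → B ⊆ E → ρ A ≡ ρ X → ρ B ≡ ρ X → ρ (A ∪ B) ≡ ρ X
    ρ-∪-≡ {X = X} {A = A} {B = B} X⊆A X⊆B A⊆E B⊆E ρA≡ρX ρB≡ρX =
      ≤-antisym (+-cancelʳ-≤ (ρ X) _ _ ρ[A∪B]+ρX≤) (monotone (p⊆p∪q B ∘ X⊆A) (∪-⊆ A⊆E B⊆E))
      where
      ρ[A∪B]+ρX≤ : ρ (A ∪ B) + ρ X ≤ ρ X + ρ X
      ρ[A∪B]+ρX≤ = begin
        ρ (A ∪ B) + ρ X       ≤⟨ +-monoʳ-≤ _ (monotone (λ x∈X → x∈p∩q⁺ (X⊆A x∈X , X⊆B x∈X)) (A⊆E ∘ p∩q⊆p A B)) ⟩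
        ρ (A ∪ B) + ρ (A ∩ B) ≤⟨ submodular A⊆E B⊆E ⟩
        ρ A + ρ B             ≡⟨ cong₂ _+_ ρA≡ρX ρB≡ρX ⟩
        ρ X + ρ X             ∎

    ρ-∪-spanned : X ⊆ E → A ⊆ E → (∀ {e} → e ∈ A → ρ (X ∪ ⁅ e ⁆) ≡ ρ X) → ρ (X ∪ A) ≡ ρ X
    ρ-∪-spanned {A = A} = go ∣ A ∣ ≤-refl
      where
      go : ∀ k {X A} → ∣ A ∣ ≤ k → X ⊆ E → A ⊆ E → (∀ {e} → e ∈ A → ρ (X ∪ ⁅ e ⁆) ≡ ρ X) → ρ (X ∪ A) ≡ ρ X
      go k {X} {A} ∣A∣≤k X⊆E A⊆E spanned with nonempty? A
      ... | no A-empty = cong ρ (trans (cong (X ∪_) (Empty-unique A-empty)) (∪-identityʳ X))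
      go zero    ∣A∣≤0 _ _ _ | yes (e , e∈A) = contradiction (<-≤-trans (x∈p⇒∣p-x∣<∣p∣ e∈A) ∣A∣≤0) n≮0
      go (suc k) {X} {A} ∣A∣≤k X⊆E A⊆E spanned | yes (e , e∈A) = subst (λ S → ρ S ≡ ρ X) X∪[A-e]∪[X∪⁅e⁆]≡X∪A
        (ρ-∪-≡ (p⊆p∪q _) (p⊆p∪q _) (∪-⊆ X⊆E (A⊆E ∘ p─q⊆p A ⁅ e ⁆)) (∪-⊆ X⊆E (x∈p⇒⁅x⁆⊆p (A⊆E e∈A)))
          (go k (s≤s⁻¹ (<-≤-trans (x∈p⇒∣p-x∣<∣p∣ e∈A) ∣A∣≤k)) X⊆E (A⊆E ∘ p─q⊆p A ⁅ e ⁆) (spanned ∘ p─q⊆p A ⁅ e ⁆))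
          (spanned e∈A))
        where
        X∪[A-e]∪[X∪⁅e⁆]≡X∪A : (X ∪ (A - e)) ∪ (X ∪ ⁅ e ⁆) ≡ X ∪ A
        X∪[A-e]∪[X∪⁅e⁆]≡X∪A = trans (sym (r∪[p∪q]≡[r∪p]∪[r∪q] X (A - e) ⁅ e ⁆)) (cong (X ∪_) (x∈p⇒[p-x]∪⁅x⁆≡p e∈A))


  record IsRankOf (N : SetSys n) (ρ : Subset n → ℕ) : Set where
    field
      axioms : RankAxioms (ground N) ρ
      basis⁻ : Basis N B → B ⊆ ground N × ρ B ≡ ∣ B ∣ × ρ B ≡ ρ (ground N)
      basis⁺ : B ⊆ ground N → ρ B ≡ ∣ B ∣ → ρ B ≡ ρ (ground N) → Basis N B

  module IsRankOfProperties {N : SetSys n} {ρ : Subset n → ℕ} (isRank : IsRankOf N ρ) where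

    open IsRankOf isRank
    open RankAxioms axioms
    open RankAxiomsProperties axioms

    private
      G = ground N

    indep⇒ρ≡∣∣ : Indep N X → X ⊆ G × ρ X ≡ ∣ X ∣
    indep⇒ρ≡∣∣ {X = X} indepX with indep⇒⊆basis N indepX
    ... | B , basisB , X⊆B with basis⁻ basisB
    ...   | B⊆G , ρB≡∣B∣ , _ = B⊆G ∘ X⊆B , ≤-antisym (bounded (B⊆G ∘ X⊆B)) (+-cancelʳ-≤ ∣ B ─ X ∣ _ _ ∣X∣+∣B─X∣≤)
      where
      ∣X∣+∣B─X∣≤ : ∣ X ∣ + ∣ B ─ X ∣ ≤ ρ X + ∣ B ─ X ∣
      ∣X∣+∣B─X∣≤ = begin
        ∣ X ∣ + ∣ B ─ X ∣   ≡⟨ sym (p⊆q⇒∣q∣≡∣p∣+∣q─p∣ X⊆B) ⟩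
        ∣ B ∣               ≡⟨ sym ρB≡∣B∣ ⟩
        ρ B                 ≡⟨ cong ρ (sym (p⊆q⇒p∪[q─p]≡q X⊆B)) ⟩
        ρ (X ∪ (B ─ X))     ≤⟨ subadditive (B⊆G ∘ X⊆B) (B⊆G ∘ p─q⊆p B X) ⟩
        ρ X + ∣ B ─ X ∣     ∎

    ρ≡∣∣⇒⊆basis : X ⊆ G → ρ X ≡ ∣ X ∣ → ∃[ B ] Basis N B × X ⊆ B
    ρ≡∣∣⇒⊆basis {X = X} = go ∣ G ─ X ∣ ≤-refl
      where
      go : ∀ k {X} → ∣ G ─ X ∣ ≤ k → X ⊆ G → ρ X ≡ ∣ X ∣ → ∃[ B ] Basis N B × X ⊆ B
      go k {X} ∣G─X∣≤k X⊆G ρX≡∣X∣ with any? (λ e → e ∈? G ×-dec ¬? (e ∈? X) ×-dec ρ (X ∪ ⁅ e ⁆) ≟ suc (ρ X))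
      ... | no ¬augmentable = X , basis⁺ X⊆G ρX≡∣X∣ (sym ρG≡ρX) , id
        where
        spanned : e ∈ G ─ X → ρ (X ∪ ⁅ e ⁆) ≡ ρ X
        spanned {e = e} e∈G─X = ρ-∪⁅⁆≡ X⊆G e∈G (λ ≡suc → ¬augmentable (e , e∈G , x∈p─q⇒x∉q G X e∈G─X , ≡suc))
          where e∈G = p─q⊆p G X e∈G─X
        ρG≡ρX : ρ G ≡ ρ X
        ρG≡ρX = trans (cong ρ (sym (p⊆q⇒p∪[q─p]≡q X⊆G))) (ρ-∪-spanned X⊆G (p─q⊆p G X) spanned)
      go zero    ∣G─X∣≤0 _ _ | yes (e , e∈G , e∉X , _) =
        contradiction (<-≤-trans (x∈p⇒∣p-x∣<∣p∣ (x∈p∧x∉q⇒x∈p─q e∈G e∉X)) ∣G─X∣≤0) n≮0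
      go (suc k) {X} ∣G─X∣≤k X⊆G ρX≡∣X∣ | yes (e , e∈G , e∉X , ρ[X∪⁅e⁆]≡) =
        let B , basisB , X∪⁅e⁆⊆B = go k ∣G─[X∪⁅e⁆]∣≤k (∪-⊆ X⊆G (x∈p⇒⁅x⁆⊆p e∈G)) (ρ-∪⁅⁆≡∣∣ e∉X ρX≡∣X∣ ρ[X∪⁅e⁆]≡)
        in B , basisB , X∪⁅e⁆⊆B ∘ p⊆p∪q ⁅ e ⁆
        where
        ∣G─[X∪⁅e⁆]∣≤k : ∣ G ─ (X ∪ ⁅ e ⁆) ∣ ≤ k
        ∣G─[X∪⁅e⁆]∣≤k = s≤s⁻¹ (<-≤-trans (subst (λ S → ∣ S ∣ < ∣ G ─ X ∣) (p─q─r≡p─q∪r G X ⁅ e ⁆)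
                                            (x∈p⇒∣p-x∣<∣p∣ (x∈p∧x∉q⇒x∈p─q e∈G e∉X))) ∣G─X∣≤k)

    ρ≡∣∣⇒indep : X ⊆ G → ρ X ≡ ∣ X ∣ → Indep N X
    ρ≡∣∣⇒indep X⊆G ρX≡∣X∣ = let B , basisB , X⊆B = ρ≡∣∣⇒⊆basis X⊆G ρX≡∣X∣ in ⊆basis⇒indep N basisB X⊆B

    restrict-isRank : ∀ A → IsRankOf (restrict N A) ρ
    restrict-isRank A = record
      { axioms = RankAxioms-⊆ A′⊆G axioms
      ; basis⁻ = restrictBasis⁻
      ; basis⁺ = restrictBasis⁺
      }
      where
      A′ = A ∩ G
      A′⊆G = p∩q⊆q A G

      restrictBasis⁻ : Basis (restrict N A) X → X ⊆ A′ × ρ X ≡ ∣ X ∣ × ρ X ≡ ρ A′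
      restrictBasis⁻ {X = X} b with restrict-basis⁻ b
      ... | X⊆A′ , indepX , maximal = X⊆A′ , ρX≡∣X∣ , sym ρA′≡ρX
        where
        ρX≡∣X∣ = proj₂ (indep⇒ρ≡∣∣ indepX)
        spanned : e ∈ A′ ─ X → ρ (X ∪ ⁅ e ⁆) ≡ ρ X
        spanned e∈A′─X = ρ-∪⁅⁆≡ (A′⊆G ∘ X⊆A′) (A′⊆G e∈A′) λ ≡suc →
          maximal e∈A′ e∉X (ρ≡∣∣⇒indep (∪-⊆ (A′⊆G ∘ X⊆A′) (x∈p⇒⁅x⁆⊆p (A′⊆G e∈A′))) (ρ-∪⁅⁆≡∣∣ e∉X ρX≡∣X∣ ≡suc))
          where
          e∈A′ = p─q⊆p A′ X e∈A′─X
          e∉X = x∈p─q⇒x∉q A′ X e∈A′─X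
        ρA′≡ρX : ρ A′ ≡ ρ X
        ρA′≡ρX = trans (cong ρ (sym (p⊆q⇒p∪[q─p]≡q X⊆A′))) (ρ-∪-spanned (A′⊆G ∘ X⊆A′) (A′⊆G ∘ p─q⊆p A′ X) spanned)

      restrictBasis⁺ : X ⊆ A′ → ρ X ≡ ∣ X ∣ → ρ X ≡ ρ A′ → Basis (restrict N A) X
      restrictBasis⁺ {X = X} X⊆A′ ρX≡∣X∣ ρX≡ρA′ = restrict-basis⁺ X⊆A′ (ρ≡∣∣⇒indep (A′⊆G ∘ X⊆A′) ρX≡∣X∣) maximal
        where
        maximal : e ∈ A′ → e ∉ X → ¬ Indep N (X ∪ ⁅ e ⁆)
        maximal {e = e} e∈A′ e∉X indepX∪⁅e⁆ = <-irrefl refl (begin-strict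
          ρ A′               ≡⟨ sym ρX≡ρA′ ⟩
          ρ X                <⟨ n<1+n (ρ X) ⟩
          suc (ρ X)          ≡⟨ cong suc ρX≡∣X∣ ⟩
          suc ∣ X ∣          ≡⟨ sym (x∉p⇒∣p∪⁅x⁆∣≡1+∣p∣ X e∉X) ⟩
          ∣ X ∪ ⁅ e ⁆ ∣      ≡⟨ sym (proj₂ (indep⇒ρ≡∣∣ indepX∪⁅e⁆)) ⟩
          ρ (X ∪ ⁅ e ⁆)      ≤⟨ monotone (∪-⊆ X⊆A′ (x∈p⇒⁅x⁆⊆p e∈A′)) A′⊆G ⟩
          ρ A′               ∎)

  -- Duality and contraction

  private
    rearrange₀ : ∀ a b c → a + (b + c) ≡ a + c + b
    rearrange₀ = solve-∀
    rearrange₁ : ∀ a b c → a + b + c ≡ b + (c + a)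
    rearrange₁ = solve-∀
    rearrange₂ : ∀ a b c → a + (b + c) ≡ b + a + c
    rearrange₂ = solve-∀

  -- For X ⊆ G the truncated subtraction is exact, see ρ*+ρG.
  dualRank : Subset n → (Subset n → ℕ) → Subset n → ℕ
  dualRank G ρ X = ∣ X ∣ + ρ (G ─ X) ∸ ρ G

  module DualRankProperties {G : Subset n} {ρ : Subset n → ℕ} (ax : RankAxioms G ρ) where

    open RankAxioms ax
    open RankAxiomsProperties ax

    private
      ρ* = dualRank G ρ

    ρG≤∣X∣+ρ[G─X] : X ⊆ G → ρ G ≤ ∣ X ∣ + ρ (G ─ X)
    ρG≤∣X∣+ρ[G─X] {X = X} X⊆G = begin
      ρ G                 ≡⟨ cong ρ (sym (trans (∪-comm (G ─ X) X) (p⊆q⇒p∪[q─p]≡q X⊆G))) ⟩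
      ρ ((G ─ X) ∪ X)     ≤⟨ subadditive (p─q⊆p G X) X⊆G ⟩
      ρ (G ─ X) + ∣ X ∣   ≡⟨ +-comm (ρ (G ─ X)) ∣ X ∣ ⟩
      ∣ X ∣ + ρ (G ─ X)   ∎

    ρ*+ρG : X ⊆ G → ρ* X + ρ G ≡ ∣ X ∣ + ρ (G ─ X)
    ρ*+ρG X⊆G = m∸n+n≡m (ρG≤∣X∣+ρ[G─X] X⊆G)

    ρ*[G]+ρG : ρ* G + ρ G ≡ ∣ G ∣
    ρ*[G]+ρG = begin-equality
      ρ* G + ρ G          ≡⟨ ρ*+ρG {X = G} ⊆-refl ⟩
      ∣ G ∣ + ρ (G ─ G)   ≡⟨ cong (λ S → ∣ G ∣ + ρ S) (p─p≡⊥ G) ⟩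
      ∣ G ∣ + ρ ⊥         ≡⟨ cong (∣ G ∣ +_) ρ⊥≡0 ⟩
      ∣ G ∣ + 0           ≡⟨ +-identityʳ _ ⟩
      ∣ G ∣               ∎

    ρ*[G─A]+[ρG∸ρA] : A ⊆ G → ρ* (G ─ A) + (ρ G ∸ ρ A) ≡ ∣ G ─ A ∣
    ρ*[G─A]+[ρG∸ρA] {A = A} A⊆G = +-cancelʳ-≡ (ρ A) _ _ (begin-equality
      ρ* (G ─ A) + (ρ G ∸ ρ A) + ρ A     ≡⟨ +-assoc (ρ* (G ─ A)) _ _ ⟩
      ρ* (G ─ A) + (ρ G ∸ ρ A + ρ A)     ≡⟨ cong (ρ* (G ─ A) +_) (m∸n+n≡m (monotone A⊆G ⊆-refl)) ⟩
      ρ* (G ─ A) + ρ G                   ≡⟨ ρ*+ρG (p─q⊆p G A) ⟩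
      ∣ G ─ A ∣ + ρ (G ─ (G ─ A))        ≡⟨ cong (λ S → ∣ G ─ A ∣ + ρ S) (p⊆q⇒q─[q─p]≡p A⊆G) ⟩
      ∣ G ─ A ∣ + ρ A                    ∎)

    ρ*[G]∸ρ*[G─A] : A ⊆ G → ρ* G ∸ ρ* (G ─ A) ≡ ∣ A ∣ ∸ ρ A
    ρ*[G]∸ρ*[G─A] {A = A} A⊆G = begin-equality
      ρ* G ∸ ρ* (G ─ A)                         ≡⟨ sym ([m+n]∸[m+o]≡n∸o (ρ A) _ _) ⟩
      (ρ A + ρ* G) ∸ (ρ A + ρ* (G ─ A))         ≡⟨ cong₂ _∸_ ρA+ρ*G≡ (+-comm (ρ A) _) ⟩
      (ρ* (G ─ A) + ∣ A ∣) ∸ (ρ* (G ─ A) + ρ A) ≡⟨ [m+n]∸[m+o]≡n∸o (ρ* (G ─ A)) _ _ ⟩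
      ∣ A ∣ ∸ ρ A                               ∎
      where
      k = ρ G ∸ ρ A
      ρA+ρ*G≡ : ρ A + ρ* G ≡ ρ* (G ─ A) + ∣ A ∣
      ρA+ρ*G≡ = +-cancelʳ-≡ k _ _ (begin-equality
        ρ A + ρ* G + k              ≡⟨ rearrange₁ (ρ A) (ρ* G) k ⟩
        ρ* G + (k + ρ A)            ≡⟨ cong (ρ* G +_) (m∸n+n≡m (monotone A⊆G ⊆-refl)) ⟩
        ρ* G + ρ G                  ≡⟨ ρ*[G]+ρG ⟩
        ∣ G ∣                       ≡⟨ p⊆q⇒∣q∣≡∣p∣+∣q─p∣ A⊆G ⟩
        ∣ A ∣ + ∣ G ─ A ∣           ≡⟨ cong (∣ A ∣ +_) (sym (ρ*[G─A]+[ρG∸ρA] A⊆G)) ⟩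
        ∣ A ∣ + (ρ* (G ─ A) + k)    ≡⟨ rearrange₂ (∣ A ∣) (ρ* (G ─ A)) k ⟩
        ρ* (G ─ A) + ∣ A ∣ + k      ∎)


    ρ*-bounded : X ⊆ G → ρ* X ≤ ∣ X ∣
    ρ*-bounded {X = X} X⊆G = +-cancelʳ-≤ (ρ G) _ _ (begin
      ρ* X + ρ G          ≡⟨ ρ*+ρG X⊆G ⟩
      ∣ X ∣ + ρ (G ─ X)   ≤⟨ +-monoʳ-≤ ∣ X ∣ (monotone (p─q⊆p G X) ⊆-refl) ⟩
      ∣ X ∣ + ρ G         ∎)

    ρ*-monotone : X ⊆ Y → Y ⊆ G → ρ* X ≤ ρ* Y
    ρ*-monotone {X = X} {Y = Y} X⊆Y Y⊆G = +-cancelʳ-≤ (ρ G) _ _ (begin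
      ρ* X + ρ G                      ≡⟨ ρ*+ρG (Y⊆G ∘ X⊆Y) ⟩
      ∣ X ∣ + ρ (G ─ X)               ≡⟨ cong (λ S → ∣ X ∣ + ρ S) (sym (p⊆q⊆r⇒[r─q]∪[q─p]≡r─p X⊆Y Y⊆G)) ⟩
      ∣ X ∣ + ρ ((G ─ Y) ∪ (Y ─ X))   ≤⟨ +-monoʳ-≤ ∣ X ∣ (subadditive (p─q⊆p G Y) (Y⊆G ∘ p─q⊆p Y X)) ⟩
      ∣ X ∣ + (ρ (G ─ Y) + ∣ Y ─ X ∣) ≡⟨ rearrange₀ (∣ X ∣) (ρ (G ─ Y)) (∣ Y ─ X ∣) ⟩
      ∣ X ∣ + ∣ Y ─ X ∣ + ρ (G ─ Y)   ≡⟨ cong (_+ ρ (G ─ Y)) (sym (p⊆q⇒∣q∣≡∣p∣+∣q─p∣ X⊆Y)) ⟩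
      ∣ Y ∣ + ρ (G ─ Y)               ≡⟨ sym (ρ*+ρG Y⊆G) ⟩
      ρ* Y + ρ G                      ∎)

    ρ*-submodular : X ⊆ G → Y ⊆ G → ρ* (X ∪ Y) + ρ* (X ∩ Y) ≤ ρ* X + ρ* Y
    ρ*-submodular {X = X} {Y = Y} X⊆G Y⊆G = +-cancelʳ-≤ (ρ G + ρ G) _ _ (begin
      ρ* (X ∪ Y) + ρ* (X ∩ Y) + (ρ G + ρ G)
        ≡⟨ interchange (ρ* (X ∪ Y)) (ρ* (X ∩ Y)) (ρ G) (ρ G) ⟩
      (ρ* (X ∪ Y) + ρ G) + (ρ* (X ∩ Y) + ρ G)
        ≡⟨ cong₂ _+_ (ρ*+ρG (∪-⊆ X⊆G Y⊆G)) (ρ*+ρG (X⊆G ∘ p∩q⊆p X Y)) ⟩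
      (∣ X ∪ Y ∣ + ρ (G ─ (X ∪ Y))) + (∣ X ∩ Y ∣ + ρ (G ─ (X ∩ Y)))
        ≡⟨ interchange (∣ X ∪ Y ∣) (ρ (G ─ (X ∪ Y))) (∣ X ∩ Y ∣) (ρ (G ─ (X ∩ Y))) ⟩
      (∣ X ∪ Y ∣ + ∣ X ∩ Y ∣) + (ρ (G ─ (X ∪ Y)) + ρ (G ─ (X ∩ Y)))
        ≡⟨ cong₂ _+_ (∣p∪q∣+∣p∩q∣≡∣p∣+∣q∣ X Y)
                     (cong₂ (λ S T → ρ S + ρ T) (r─[p∪q]≡[r─p]∩[r─q] G X Y) (r─[p∩q]≡[r─p]∪[r─q] G X Y)) ⟩
      (∣ X ∣ + ∣ Y ∣) + (ρ ((G ─ X) ∩ (G ─ Y)) + ρ ((G ─ X) ∪ (G ─ Y)))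
        ≤⟨ +-monoʳ-≤ (∣ X ∣ + ∣ Y ∣) (≤-trans (≤-reflexive (+-comm (ρ ((G ─ X) ∩ (G ─ Y))) _))
                                           (submodular (p─q⊆p G X) (p─q⊆p G Y))) ⟩
      (∣ X ∣ + ∣ Y ∣) + (ρ (G ─ X) + ρ (G ─ Y))
        ≡⟨ interchange (∣ X ∣) (∣ Y ∣) (ρ (G ─ X)) (ρ (G ─ Y)) ⟩
      (∣ X ∣ + ρ (G ─ X)) + (∣ Y ∣ + ρ (G ─ Y))
        ≡⟨ sym (cong₂ _+_ (ρ*+ρG X⊆G) (ρ*+ρG Y⊆G)) ⟩
      (ρ* X + ρ G) + (ρ* Y + ρ G)
        ≡⟨ interchange (ρ* X) (ρ G) (ρ* Y) (ρ G) ⟩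
      ρ* X + ρ* Y + (ρ G + ρ G) ∎)

    dual-axioms : RankAxioms G ρ*
    dual-axioms = record { bounded = ρ*-bounded ; monotone = ρ*-monotone ; submodular = ρ*-submodular }

  module _ {N : SetSys n} {ρ : Subset n → ℕ} (isRank : IsRankOf N ρ) where

    open IsRankOf isRank
    open DualRankProperties axioms

    private
      G = ground N
      ρ* = dualRank G ρ

    dual-isRank : IsRankOf (dual N) ρ*
    dual-isRank = record { axioms = dual-axioms ; basis⁻ = dualBasis⁻ ; basis⁺ = dualBasis⁺ }
      where
      dualBasis⁻ : Basis (dual N) X → X ⊆ G × ρ* X ≡ ∣ X ∣ × ρ* X ≡ ρ* G
      dualBasis⁻ {X = X} b with dual-basis⁻ {N = N} b
      ... | X⊆G , basisG─X with basis⁻ basisG─X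
      ...   | _ , ρ[G─X]≡∣G─X∣ , ρ[G─X]≡ρG = X⊆G , ρ*X≡∣X∣ , trans ρ*X≡∣X∣ (sym ρ*G≡∣X∣)
        where
        ρ*X≡∣X∣ : ρ* X ≡ ∣ X ∣
        ρ*X≡∣X∣ = +-cancelʳ-≡ (ρ G) _ _ (trans (ρ*+ρG X⊆G) (cong (∣ X ∣ +_) ρ[G─X]≡ρG))
        ρ*G≡∣X∣ : ρ* G ≡ ∣ X ∣
        ρ*G≡∣X∣ = +-cancelʳ-≡ (ρ G) _ _ (begin-equality
          ρ* G + ρ G          ≡⟨ ρ*[G]+ρG ⟩
          ∣ G ∣               ≡⟨ p⊆q⇒∣q∣≡∣p∣+∣q─p∣ X⊆G ⟩
          ∣ X ∣ + ∣ G ─ X ∣   ≡⟨ cong (∣ X ∣ +_) (trans (sym ρ[G─X]≡∣G─X∣) ρ[G─X]≡ρG) ⟩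
          ∣ X ∣ + ρ G         ∎)

      dualBasis⁺ : X ⊆ G → ρ* X ≡ ∣ X ∣ → ρ* X ≡ ρ* G → Basis (dual N) X
      dualBasis⁺ {X = X} X⊆G ρ*X≡∣X∣ ρ*X≡ρ*G =
        dual-basis⁺ {N = N} X⊆G (basis⁺ (p─q⊆p G X) (trans ρ[G─X]≡ρG (sym ∣G─X∣≡ρG)) ρ[G─X]≡ρG)
        where
        ρ[G─X]≡ρG : ρ (G ─ X) ≡ ρ G
        ρ[G─X]≡ρG = +-cancelˡ-≡ ∣ X ∣ _ _ (trans (sym (ρ*+ρG X⊆G)) (cong (_+ ρ G) ρ*X≡∣X∣))
        ∣G─X∣≡ρG : ∣ G ─ X ∣ ≡ ρ G
        ∣G─X∣≡ρG = +-cancelˡ-≡ ∣ X ∣ _ _ (begin-equality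
          ∣ X ∣ + ∣ G ─ X ∣   ≡⟨ sym (p⊆q⇒∣q∣≡∣p∣+∣q─p∣ X⊆G) ⟩
          ∣ G ∣               ≡⟨ sym ρ*[G]+ρG ⟩
          ρ* G + ρ G          ≡⟨ cong (_+ ρ G) (trans (sym ρ*X≡ρ*G) ρ*X≡∣X∣) ⟩
          ∣ X ∣ + ρ G         ∎)

  contractRank : Subset n → (Subset n → ℕ) → Subset n → Subset n → ℕ
  contractRank G ρ A = dualRank ((G ─ A) ∩ G) (dualRank G ρ)

  contract-isRank : ∀ {ρ} → IsRankOf N ρ → ∀ A → IsRankOf (contract N A) (contractRank (ground N) ρ A)
  contract-isRank {N = N} isRank A = dual-isRank (restrict-isRank (dual-isRank isRank) (ground N ─ A))
    where open IsRankOfProperties using (restrict-isRank)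

  contractRank-ground : ∀ {G : Subset n} {ρ} → RankAxioms G ρ → A ⊆ G → contractRank G ρ A ((G ─ A) ∩ G) ≡ ρ G ∸ ρ A
  contractRank-ground {A = A} {G = G} {ρ = ρ} ax A⊆G = +-cancelˡ-≡ (ρ* G′) _ _ (begin-equality
    ρ* G′ + contractRank G ρ A G′   ≡⟨ +-comm (ρ* G′) _ ⟩
    contractRank G ρ A G′ + ρ* G′   ≡⟨ DualRankProperties.ρ*[G]+ρG (RankAxioms-⊆ (p∩q⊆q (G ─ A) G) (dual-axioms ax)) ⟩
    ∣ G′ ∣                          ≡⟨ cong ∣_∣ G′≡G─A ⟩
    ∣ G ─ A ∣                       ≡⟨ sym (ρ*[G─A]+[ρG∸ρA] ax A⊆G) ⟩
    ρ* (G ─ A) + (ρ G ∸ ρ A)        ≡⟨ cong (λ S → ρ* S + (ρ G ∸ ρ A)) (sym G′≡G─A) ⟩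
    ρ* G′ + (ρ G ∸ ρ A)             ∎)
    where
    open DualRankProperties using (dual-axioms; ρ*[G─A]+[ρG∸ρA])
    ρ* = dualRank G ρ
    G′ = (G ─ A) ∩ G
    G′≡G─A : G′ ≡ G ─ A
    G′≡G─A = [p─q]∩p≡p─q G A

  -- The rank function of a matroid

  module MatroidRank (M : Matroid n) where

    private
      IsBasis = Basis (toSys M)
      B₀ = proj₁ (Matroid.nonempty M)
      bases = filter (T? ∘ Matroid.isBasis M) (allSubsets n)

    basis-exchange : IsBasis A → IsBasis B → x ∈ A → x ∉ B → ∃[ y ] y ∈ B × y ∉ A × IsBasis ((A - x) ∪ ⁅ y ⁆)
    basis-exchange basisA basisB x∈A x∉B with Matroid.exchange M _ _ (to T-≡ basisA) (to T-≡ basisB) _ x∈A x∉B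
    ... | y , y∈B , y∉A , basis = y , y∈B , y∉A , from T-≡ basis

    ∣exchanged∣≡ : x ∈ A → e ∉ A → ∣ (A - x) ∪ ⁅ e ⁆ ∣ ≡ ∣ A ∣
    ∣exchanged∣≡ {A = A} x∈A e∉A = trans (x∉p⇒∣p∪⁅x⁆∣≡1+∣p∣ _ (e∉A ∘ p─q⊆p A _)) (sym (x∈p⇒∣p∣≡1+∣p-x∣ x∈A))

    ∣exchanged─B∣<∣A─B∣ : x ∈ A → x ∉ B → e ∈ B → ∣ ((A - x) ∪ ⁅ e ⁆) ─ B ∣ < ∣ A ─ B ∣
    ∣exchanged─B∣<∣A─B∣ {x = x} {A = A} {B = B} x∈A x∉B e∈B = begin-strict
      ∣ ((A - x) ∪ ⁅ _ ⁆) ─ B ∣ ≡⟨ cong ∣_∣ (trans (x∈q⇒[p∪⁅x⁆]─q≡p─q (A - x) B e∈B) (p─q─r≡p─r─q A ⁅ x ⁆ B)) ⟩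
      ∣ (A ─ B) - x ∣          <⟨ x∈p⇒∣p-x∣<∣p∣ (x∈p∧x∉q⇒x∈p─q x∈A x∉B) ⟩
      ∣ A ─ B ∣                ∎

    ∣basis∣≡∣basis∣ : IsBasis A → IsBasis B → ∣ A ∣ ≡ ∣ B ∣
    ∣basis∣≡∣basis∣ {A = A} {B = B} = go ∣ A ─ B ∣ ≤-refl
      where
      go : ∀ k {A B} → ∣ A ─ B ∣ ≤ k → IsBasis A → IsBasis B → ∣ A ∣ ≡ ∣ B ∣
      go k {A} {B} ∣A─B∣≤k basisA basisB with nonempty? (A ─ B)
      ... | no A─B-empty = cong ∣_∣ (⊆-antisym A⊆B B⊆A)
        where
        A⊆B : A ⊆ B
        A⊆B {x} x∈A with x ∈? B
        ... | yes x∈B = x∈B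
        ... | no  x∉B = contradiction (x , x∈p∧x∉q⇒x∈p─q x∈A x∉B) A─B-empty
        B⊆A : B ⊆ A
        B⊆A {x} x∈B with x ∈? A
        ... | yes x∈A = x∈A
        ... | no  x∉A = let y , y∈A , y∉B , _ = basis-exchange basisB basisA x∈B x∉A in contradiction (A⊆B y∈A) y∉B
      go zero    ∣A─B∣≤0 _ _ | yes (x , x∈A─B) = contradiction (<-≤-trans (x∈p⇒∣p-x∣<∣p∣ x∈A─B) ∣A─B∣≤0) n≮0
      go (suc k) {A} {B} ∣A─B∣≤k basisA basisB | yes (x , x∈A─B) =
        let y , y∈B , y∉A , basisA′ = basis-exchange basisA basisB x∈A x∉B
        in trans (sym (∣exchanged∣≡ x∈A y∉A))
                 (go k (s≤s⁻¹ (<-≤-trans (∣exchanged─B∣<∣A─B∣ x∈A x∉B y∈B) ∣A─B∣≤k)) basisA′ basisB)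
        where
        x∈A = p─q⊆p A B x∈A─B
        x∉B = x∈p─q⇒x∉q A B x∈A─B

    -- Exchanging an element of A ─ B outside W for one of B keeps W ∩ A and shrinks A ─ B;
    -- once A ─ B ⊆ W, equicardinality of bases gives ∣ W ∩ B ∣ ≤ ∣ W ∩ A ∣.
    basis-∩-augment : ∀ (W : Subset n) {A B} → IsBasis A → IsBasis B →
                      ∃[ C ] IsBasis C × W ∩ A ⊆ C × ∣ W ∩ B ∣ ≤ ∣ W ∩ C ∣
    basis-∩-augment W {A} {B} = go ∣ A ─ B ∣ ≤-refl
      where
      go : ∀ k {A} → ∣ A ─ B ∣ ≤ k → IsBasis A → IsBasis B → ∃[ C ] IsBasis C × W ∩ A ⊆ C × ∣ W ∩ B ∣ ≤ ∣ W ∩ C ∣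
      go k {A} ∣A─B∣≤k basisA basisB with any? (λ y → y ∈? A ×-dec ¬? (y ∈? B) ×-dec ¬? (y ∈? W))
      ... | no ¬outside = A , basisA , p∩q⊆q W A , ∣W∩B∣≤∣W∩A∣
        where
        A─B⊆[W∩A]─B : A ─ B ⊆ (W ∩ A) ─ B
        A─B⊆[W∩A]─B {y} y∈A─B with y ∈? W
        ... | yes y∈W = x∈p∧x∉q⇒x∈p─q (x∈p∩q⁺ (y∈W , p─q⊆p A B y∈A─B)) (x∈p─q⇒x∉q A B y∈A─B)
        ... | no  y∉W = contradiction (y , p─q⊆p A B y∈A─B , x∈p─q⇒x∉q A B y∈A─B , y∉W) ¬outside
        [W∩B]─A⊆B─A : (W ∩ B) ─ A ⊆ B ─ A
        [W∩B]─A⊆B─A y∈ = x∈p∧x∉q⇒x∈p─q (p∩q⊆q W B (p─q⊆p (W ∩ B) A y∈)) (x∈p─q⇒x∉q (W ∩ B) A y∈)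
        ∣B─A∣≡∣A─B∣ : ∣ B ─ A ∣ ≡ ∣ A ─ B ∣
        ∣B─A∣≡∣A─B∣ = +-cancelˡ-≡ ∣ A ∩ B ∣ _ _ (begin-equality
          ∣ A ∩ B ∣ + ∣ B ─ A ∣  ≡⟨ cong (λ S → ∣ S ∣ + ∣ B ─ A ∣) (∩-comm A B) ⟩
          ∣ B ∩ A ∣ + ∣ B ─ A ∣  ≡⟨ sym (∣p∣≡∣p∩q∣+∣p─q∣ B A) ⟩
          ∣ B ∣                  ≡⟨ ∣basis∣≡∣basis∣ basisB basisA ⟩
          ∣ A ∣                  ≡⟨ ∣p∣≡∣p∩q∣+∣p─q∣ A B ⟩
          ∣ A ∩ B ∣ + ∣ A ─ B ∣  ∎)
        [W∩B]∩A≡[W∩A]∩B : (W ∩ B) ∩ A ≡ (W ∩ A) ∩ B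
        [W∩B]∩A≡[W∩A]∩B = trans (∩-assoc W B A) (trans (cong (W ∩_) (∩-comm B A)) (sym (∩-assoc W A B)))
        ∣W∩B∣≤∣W∩A∣ : ∣ W ∩ B ∣ ≤ ∣ W ∩ A ∣
        ∣W∩B∣≤∣W∩A∣ = begin
          ∣ W ∩ B ∣                          ≡⟨ ∣p∣≡∣p∩q∣+∣p─q∣ (W ∩ B) A ⟩
          ∣ (W ∩ B) ∩ A ∣ + ∣ (W ∩ B) ─ A ∣  ≤⟨ +-monoʳ-≤ _ (p⊆q⇒∣p∣≤∣q∣ [W∩B]─A⊆B─A) ⟩
          ∣ (W ∩ B) ∩ A ∣ + ∣ B ─ A ∣        ≡⟨ cong₂ _+_ (cong ∣_∣ [W∩B]∩A≡[W∩A]∩B) ∣B─A∣≡∣A─B∣ ⟩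
          ∣ (W ∩ A) ∩ B ∣ + ∣ A ─ B ∣        ≤⟨ +-monoʳ-≤ _ (p⊆q⇒∣p∣≤∣q∣ A─B⊆[W∩A]─B) ⟩
          ∣ (W ∩ A) ∩ B ∣ + ∣ (W ∩ A) ─ B ∣  ≡⟨ sym (∣p∣≡∣p∩q∣+∣p─q∣ (W ∩ A) B) ⟩
          ∣ W ∩ A ∣                          ∎
      go zero ∣A─B∣≤0 _ _ | yes (y , y∈A , y∉B , _) =
        contradiction (<-≤-trans (x∈p⇒∣p-x∣<∣p∣ (x∈p∧x∉q⇒x∈p─q y∈A y∉B)) ∣A─B∣≤0) n≮0
      go (suc k) {A} ∣A─B∣≤k basisA basisB | yes (y , y∈A , y∉B , y∉W) =
        let z , z∈B , z∉A , basisA′ = basis-exchange basisA basisB y∈A y∉B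
            C , basisC , W∩A′⊆C , ≤∣W∩C∣ =
              go k (s≤s⁻¹ (<-≤-trans (∣exchanged─B∣<∣A─B∣ y∈A y∉B z∈B) ∣A─B∣≤k)) basisA′ basisB
        in C , basisC , W∩A′⊆C ∘ W∩A⊆W∩A′ , ≤∣W∩C∣
        where
        W∩A⊆W∩A′ : ∀ {z} → W ∩ A ⊆ W ∩ ((A - y) ∪ ⁅ z ⁆)
        W∩A⊆W∩A′ x∈W∩A with x∈p∩q⁻ W A x∈W∩A
        ... | x∈W , x∈A = x∈p∩q⁺ (x∈W , p⊆p∪q _ (x∈p∧x≢y⇒x∈p-y x∈A λ { refl → y∉W x∈W }))

    maxBasis : Subset n → Subset n
    maxBasis X = argmax (λ B → ∣ X ∩ B ∣) B₀ bases

    rank : Subset n → ℕ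
    rank X = ∣ X ∩ maxBasis X ∣

    maxBasis-isBasis : ∀ X → IsBasis (maxBasis X)
    maxBasis-isBasis X =
      argmax-all (λ B → ∣ X ∩ B ∣) (from T-≡ (proj₂ (Matroid.nonempty M))) (all-filter (T? ∘ Matroid.isBasis M) (allSubsets n))

    ∣∩basis∣≤rank : ∀ X → IsBasis B → ∣ X ∩ B ∣ ≤ rank X
    ∣∩basis∣≤rank {B = B} X basisB =
      All.lookup (f[xs]≤f[argmax] {f = λ B → ∣ X ∩ B ∣} B₀ bases) (∈-filter⁺ (T? ∘ Matroid.isBasis M) (∈-allSubsets B) basisB)

    rank-submodular : ∀ (X Y : Subset n) → rank (X ∪ Y) + rank (X ∩ Y) ≤ rank X + rank Y
    rank-submodular X Y = begin
      rank (X ∪ Y) + rank (X ∩ Y)                     ≤⟨ +-mono-≤ rank[X∪Y]≤ (p⊆q⇒∣p∣≤∣q∣ [X∩Y]∩B₁⊆[X∩Y]∩C) ⟩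
      ∣ (X ∪ Y) ∩ C ∣ + ∣ (X ∩ Y) ∩ C ∣
        ≡⟨ cong₂ (λ S T → ∣ S ∣ + ∣ T ∣) (∩-distribʳ-∪ C X Y) ([p∩q]∩r≡[p∩r]∩[q∩r] X Y C) ⟩
      ∣ (X ∩ C) ∪ (Y ∩ C) ∣ + ∣ (X ∩ C) ∩ (Y ∩ C) ∣   ≡⟨ ∣p∪q∣+∣p∩q∣≡∣p∣+∣q∣ (X ∩ C) (Y ∩ C) ⟩
      ∣ X ∩ C ∣ + ∣ Y ∩ C ∣                           ≤⟨ +-mono-≤ (∣∩basis∣≤rank X basisC) (∣∩basis∣≤rank Y basisC) ⟩
      rank X + rank Y                                 ∎
      where
      B₁ = maxBasis (X ∩ Y)
      augmented = basis-∩-augment (X ∪ Y) (maxBasis-isBasis (X ∩ Y)) (maxBasis-isBasis (X ∪ Y))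
      C = proj₁ augmented
      basisC = proj₁ (proj₂ augmented)
      [X∪Y]∩B₁⊆C = proj₁ (proj₂ (proj₂ augmented))
      rank[X∪Y]≤ = proj₂ (proj₂ (proj₂ augmented))
      [X∩Y]∩B₁⊆[X∩Y]∩C : (X ∩ Y) ∩ B₁ ⊆ (X ∩ Y) ∩ C
      [X∩Y]∩B₁⊆[X∩Y]∩C x∈ with x∈p∩q⁻ (X ∩ Y) B₁ x∈
      ... | x∈X∩Y , x∈B₁ = x∈p∩q⁺ (x∈X∩Y , [X∪Y]∩B₁⊆C (x∈p∩q⁺ (p⊆p∪q Y (p∩q⊆p X Y x∈X∩Y) , x∈B₁)))

    rank-axioms : RankAxioms ⊤ rank
    rank-axioms = record
      { bounded    = λ {X} _ → ∣p∩q∣≤∣p∣ X (maxBasis X)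
      ; monotone   = λ {X} {Y} X⊆Y _ →
          ≤-trans (p⊆q⇒∣p∣≤∣q∣ (λ x∈ → let x∈X , x∈B = x∈p∩q⁻ X _ x∈ in x∈p∩q⁺ (X⊆Y x∈X , x∈B)))
                  (∣∩basis∣≤rank Y (maxBasis-isBasis X))
      ; submodular = λ {X} {Y} _ _ → rank-submodular X Y
      }

    rank⊤≡∣basis∣ : IsBasis B → rank ⊤ ≡ ∣ B ∣
    rank⊤≡∣basis∣ basisB = trans (cong ∣_∣ (∩-identityˡ (maxBasis ⊤))) (∣basis∣≡∣basis∣ (maxBasis-isBasis ⊤) basisB)

    rank-isRank : IsRankOf (toSys M) rank
    rank-isRank = record { axioms = rank-axioms ; basis⁻ = basis⁻ ; basis⁺ = basis⁺ }
      where
      basis⁻ : IsBasis B → B ⊆ ⊤ × rank B ≡ ∣ B ∣ × rank B ≡ rank ⊤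
      basis⁻ {B = B} basisB = ⊆⊤ , rankB≡∣B∣ , trans rankB≡∣B∣ (sym (rank⊤≡∣basis∣ basisB))
        where
        rankB≡∣B∣ : rank B ≡ ∣ B ∣
        rankB≡∣B∣ = ≤-antisym (∣p∩q∣≤∣p∣ B _) (subst (λ S → ∣ S ∣ ≤ rank B) (∩-idem B) (∣∩basis∣≤rank B basisB))
      basis⁺ : X ⊆ ⊤ → rank X ≡ ∣ X ∣ → rank X ≡ rank ⊤ → IsBasis X
      basis⁺ {X = X} _ rankX≡∣X∣ rankX≡rank⊤ = subst IsBasis (sym X≡B) (maxBasis-isBasis X)
        where
        Bₓ = maxBasis X
        X∩B≡X : X ∩ Bₓ ≡ X
        X∩B≡X = p⊆q∧∣q∣≤∣p∣⇒p≡q (p∩q⊆p X Bₓ) (≤-reflexive (sym rankX≡∣X∣))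
        X⊆B : X ⊆ Bₓ
        X⊆B x∈X = p∩q⊆q X Bₓ (subst (_ ∈_) (sym X∩B≡X) x∈X)
        X≡B : X ≡ Bₓ
        X≡B = p⊆q∧∣q∣≤∣p∣⇒p≡q X⊆B
          (≤-reflexive (trans (sym (rank⊤≡∣basis∣ (maxBasis-isBasis X))) (trans (sym rankX≡rank⊤) rankX≡∣X∣)))

module Expansion where

  open import Algebra.Bundles using (CommutativeRing; CommutativeMonoid)
  open import Data.Bool using (Bool; true; false; T; T?; if_then_else_)
  open import Data.Bool.Properties using (T-≡)
  open import Data.Fin.Subset using (Subset; ∣_∣; ∁; _─_; _∩_; _⊆_; ⊤; ⊥; inside; outside)
  open import Data.Fin.Subset.Properties using (⊆-refl; ⊆⊤; ⊥⊆; ∣⊥∣≡0; ∣p∣≤n)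
  import Data.Integer as ℤ
  import Data.Integer.Properties as ℤₚ
  open import Data.List using ([]; _∷_; map; filter; _++_; applyUpTo; upTo)
  open import Data.List.Properties using (map-cong; map-∘; map-applyUpTo)
  open import Data.Nat as ℕ using (ℕ; zero; suc; _!; _≡ᵇ_; NonZero)
  open import Data.Nat.Coprimality using (1-coprimeTo)
  import Data.Nat.Coprimality as Coprime
  import Data.Nat.Properties as ℕₚ
  open import Data.Nat.Properties
    using (_!≢0; suc-injective; m∸[m∸n]≡n; m+n∸n≡m; m+[n∸m]≡n; n≤0⇒n≡0; n≤1⇒n≡0∨n≡1; 0≢1+n; ≡ᵇ⇒≡; ≡⇒≡ᵇ)
  open import Data.Product using (_,_; proj₁; proj₂)
  open import Data.Rational using (ℚ; 0ℚ; 1ℚ; _+_; _*_; _-_; _/_; mkℚ)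
  open import Data.Rational.Properties
  open import Data.Sum using (_⊎_; inj₁; inj₂)
  open import Data.Vec using ([]; _∷_)
  open import Function using (_∘_; id; Equivalence)
  open import Relation.Binary.PropositionalEquality
  open import Relation.Nullary using (¬_)
  open import Relation.Nullary.Negation using (contradiction)

  open CommutativeRing +-*-commutativeRing using (semiring)
  open import Algebra.Properties.Semiring.Mult semiring using (_×_; ×-assocˡ; ×-assoc-*)
  open import Algebra.Properties.Semiring.Exp semiring using (_^_; ^-homo-*)
  open import Algebra.Properties.CommutativeSemigroup (CommutativeMonoid.commutativeSemigroup *-1-commutativeMonoid)
    using (interchange)

  open RankFunctions
  open Equivalence using (to; from)
  open ≡-Reasoning

  private variable
    n : ℕ

  +m/1≡mkℚ : ∀ m → ℤ.+ m / 1 ≡ mkℚ (ℤ.+ m) 0 (Coprime.sym (1-coprimeTo m))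
  +m/1≡mkℚ m = normalize-coprime (Coprime.sym (1-coprimeTo m))

  m×1≡+m/1 : ∀ m → m × 1ℚ ≡ ℤ.+ m / 1
  m×1≡+m/1 zero    = refl
  m×1≡+m/1 (suc m) rewrite m×1≡+m/1 m | +m/1≡mkℚ m | ℤₚ.*-identityʳ (ℤ.+ m) = refl

  1/m*m≡1 : ∀ m .{{_ : NonZero m}} → (ℤ.+ 1 / m) * (m × 1ℚ) ≡ 1ℚ
  1/m*m≡1 (suc j) rewrite m×1≡+m/1 (suc j) | +m/1≡mkℚ (suc j) | normalize-coprime {1} {j} (1-coprimeTo (suc j)) =
    *-inverseˡ (mkℚ (ℤ.+ suc j) 0 (Coprime.sym (1-coprimeTo (suc j))))

  inv!*k!≡1 : ∀ k → inv! k * ((k !) × 1ℚ) ≡ 1ℚ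
  inv!*k!≡1 k = 1/m*m≡1 (k !) {{k !≢0}}

  -- Sums over subsets

  module _ {A : Set} where

    sum-map-cong : ∀ {f g : A → ℚ} → (∀ x → f x ≡ g x) → ∀ xs → sumℚ (map f xs) ≡ sumℚ (map g xs)
    sum-map-cong f≗g xs = cong sumℚ (map-cong f≗g xs)

    sum-map-++ : ∀ (f : A → ℚ) xs ys → sumℚ (map f (xs ++ ys)) ≡ sumℚ (map f xs) + sumℚ (map f ys)
    sum-map-++ f []       ys = sym (+-identityˡ _)
    sum-map-++ f (x ∷ xs) ys = trans (cong (f x +_) (sum-map-++ f xs ys)) (sym (+-assoc (f x) _ _))

    sum-map-zero : ∀ {f : A → ℚ} → (∀ x → f x ≡ 0ℚ) → ∀ xs → sumℚ (map f xs) ≡ 0ℚ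
    sum-map-zero f≗0 []       = refl
    sum-map-zero f≗0 (x ∷ xs) = trans (cong₂ _+_ (f≗0 x) (sum-map-zero f≗0 xs)) (+-identityˡ 0ℚ)

    sum-map-filter : ∀ (p : A → Bool) (f : A → ℚ) xs →
                     sumℚ (map f (filter (T? ∘ p) xs)) ≡ sumℚ (map (λ x → if p x then f x else 0ℚ) xs)
    sum-map-filter p f []       = refl
    sum-map-filter p f (x ∷ xs) with p x
    ... | true  = cong (f x +_) (sum-map-filter p f xs)
    ... | false = trans (sum-map-filter p f xs) (sym (+-identityˡ _))

  ∑ₛ : (Subset n → ℚ) → ℚ
  ∑ₛ h = sumℚ (map h (allSubsets _))

  ∑ₛ-cong : ∀ {h h′ : Subset n → ℚ} → (∀ A → h A ≡ h′ A) → ∑ₛ h ≡ ∑ₛ h′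
  ∑ₛ-cong h≗h′ = sum-map-cong h≗h′ (allSubsets _)

  ∑ₛ-suc : ∀ (h : Subset (suc n) → ℚ) → ∑ₛ h ≡ ∑ₛ (h ∘ (inside ∷_)) + ∑ₛ (h ∘ (outside ∷_))
  ∑ₛ-suc {n} h = begin
    sumℚ (map h (map (inside ∷_) (allSubsets n) ++ map (outside ∷_) (allSubsets n)))
      ≡⟨ sum-map-++ h (map (inside ∷_) (allSubsets n)) _ ⟩
    sumℚ (map h (map (inside ∷_) (allSubsets n))) + sumℚ (map h (map (outside ∷_) (allSubsets n)))
      ≡⟨ sym (cong₂ _+_ (cong sumℚ (map-∘ (allSubsets n))) (cong sumℚ (map-∘ (allSubsets n)))) ⟩
    ∑ₛ (h ∘ (inside ∷_)) + ∑ₛ (h ∘ (outside ∷_)) ∎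

  ∑ₛ-zero : ∀ {h : Subset n → ℚ} → (∀ A → h A ≡ 0ℚ) → ∑ₛ h ≡ 0ℚ
  ∑ₛ-zero h≗0 = sum-map-zero h≗0 (allSubsets _)

  ∑ₛ-∁ : ∀ (h : Subset n → ℚ) → ∑ₛ h ≡ ∑ₛ (h ∘ ∁)
  ∑ₛ-∁ {zero}  h = refl
  ∑ₛ-∁ {suc n} h = begin
    ∑ₛ h
      ≡⟨ ∑ₛ-suc h ⟩
    ∑ₛ (h ∘ (inside ∷_)) + ∑ₛ (h ∘ (outside ∷_))
      ≡⟨ cong₂ _+_ (∑ₛ-∁ (h ∘ (inside ∷_))) (∑ₛ-∁ (h ∘ (outside ∷_))) ⟩
    ∑ₛ (h ∘ (inside ∷_) ∘ ∁) + ∑ₛ (h ∘ (outside ∷_) ∘ ∁)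
      ≡⟨ +-comm (∑ₛ (h ∘ (inside ∷_) ∘ ∁)) _ ⟩
    ∑ₛ (h ∘ ∁ ∘ (inside ∷_)) + ∑ₛ (h ∘ ∁ ∘ (outside ∷_))
      ≡⟨ sym (∑ₛ-suc (h ∘ ∁)) ⟩
    ∑ₛ (h ∘ ∁) ∎

  sum-applyUpTo-single : ∀ (H : ℕ → ℚ) {m} L → m ℕ.< L → (∀ k → k ≢ m → H k ≡ 0ℚ) → sumℚ (applyUpTo H L) ≡ H m
  sum-applyUpTo-single H {zero}  (suc L) _ H≗0 = begin
    H 0 + sumℚ (applyUpTo (H ∘ suc) L)    ≡⟨ cong (H 0 +_) (cong sumℚ (sym (map-applyUpTo id (H ∘ suc) L))) ⟩
    H 0 + sumℚ (map (H ∘ suc) (upTo L))   ≡⟨ cong (H 0 +_) (sum-map-zero (λ k → H≗0 (suc k) λ ()) (upTo L)) ⟩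
    H 0 + 0ℚ                            ≡⟨ +-identityʳ (H 0) ⟩
    H 0                                 ∎
  sum-applyUpTo-single H {suc m} (suc L) (ℕ.s≤s m<L) H≗0 = begin
    H 0 + sumℚ (applyUpTo (H ∘ suc) L)
      ≡⟨ cong₂ _+_ (H≗0 0 λ ()) (sum-applyUpTo-single (H ∘ suc) L m<L (λ k k≢m → H≗0 (suc k) (k≢m ∘ suc-injective))) ⟩
    0ℚ + H (suc m)                      ≡⟨ +-identityˡ _ ⟩
    H (suc m)                           ∎

  ×-zeroʳ : ∀ m → m × 0ℚ ≡ 0ℚ
  ×-zeroʳ zero    = refl
  ×-zeroʳ (suc m) = trans (+-identityˡ _) (×-zeroʳ m)

  ⊛-∑ₛ : ∀ (f g : Fun n) N → (f ⊛ g) N ≡ ∑ₛ (λ A → if A ⊆ᵇ ground N then f (restrict N A) * g (contract N A) else 0ℚ)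
  ⊛-∑ₛ f g N = sum-map-filter (_⊆ᵇ ground N) _ (allSubsets _)

  codimIndicator : ℕ → ℚ → Subset n → Subset n → ℚ
  codimIndicator j C G A = if A ⊆ᵇ G then (if ∣ G ─ A ∣ ≡ᵇ j then C else 0ℚ) else 0ℚ

  ∑ₛ-codim0 : ∀ (G : Subset n) C → ∑ₛ (codimIndicator 0 C G) ≡ C
  ∑ₛ-codim0 []            C = +-identityʳ C
  ∑ₛ-codim0 (inside ∷ G)  C = trans (∑ₛ-suc (codimIndicator 0 C (inside ∷ G)))
    (trans (cong₂ _+_ (∑ₛ-codim0 G C) (∑ₛ-zero (λ A → if-same (A ⊆ᵇ G)))) (+-identityʳ C))
    where
    if-same : ∀ b → (if b then 0ℚ else 0ℚ) ≡ 0ℚ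
    if-same true  = refl
    if-same false = refl
  ∑ₛ-codim0 (outside ∷ G) C = trans (∑ₛ-suc (codimIndicator 0 C (outside ∷ G)))
    (trans (cong₂ _+_ (∑ₛ-zero {h = codimIndicator 0 C (outside ∷ G) ∘ (inside ∷_)} (λ _ → refl)) (∑ₛ-codim0 G C)) (+-identityˡ C))

  ∑ₛ-codim1 : ∀ (G : Subset n) C → ∑ₛ (codimIndicator 1 C G) ≡ ∣ G ∣ × C
  ∑ₛ-codim1 []            C = +-identityʳ 0ℚ
  ∑ₛ-codim1 (inside ∷ G)  C = trans (∑ₛ-suc (codimIndicator 1 C (inside ∷ G)))
    (trans (cong₂ _+_ (∑ₛ-codim1 G C) (∑ₛ-codim0 G C)) (+-comm (∣ G ∣ × C) C))
  ∑ₛ-codim1 (outside ∷ G) C = trans (∑ₛ-suc (codimIndicator 1 C (outside ∷ G)))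
    (trans (cong₂ _+_ (∑ₛ-zero {h = codimIndicator 1 C (outside ∷ G) ∘ (inside ∷_)} (λ _ → refl)) (∑ₛ-codim1 G C)) (+-identityˡ _))

  -- Exponentials of loop–coloop characters

  monomial : ℚ → ℚ → ℕ → ℕ → ℚ
  monomial a b r m = a ^ r * b ^ (m ℕ.∸ r)

  monomial-* : ∀ a b {r₁ m₁ r₂ m₂} → r₁ ℕ.≤ m₁ → r₂ ℕ.≤ m₂ →
               monomial a b r₁ m₁ * monomial a b r₂ m₂ ≡ monomial a b (r₁ ℕ.+ r₂) (m₁ ℕ.+ m₂)
  monomial-* a b {r₁} {m₁} {r₂} {m₂} r₁≤m₁ r₂≤m₂ = begin
    (a ^ r₁ * b ^ (m₁ ℕ.∸ r₁)) * (a ^ r₂ * b ^ (m₂ ℕ.∸ r₂))   ≡⟨ interchange (a ^ r₁) _ _ _ ⟩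
    (a ^ r₁ * a ^ r₂) * (b ^ (m₁ ℕ.∸ r₁) * b ^ (m₂ ℕ.∸ r₂))   ≡⟨ sym (cong₂ _*_ (^-homo-* a r₁ r₂) (^-homo-* b (m₁ ℕ.∸ r₁) _)) ⟩
    a ^ (r₁ ℕ.+ r₂) * b ^ ((m₁ ℕ.∸ r₁) ℕ.+ (m₂ ℕ.∸ r₂))
      ≡⟨ cong (λ e → a ^ (r₁ ℕ.+ r₂) * b ^ e) (sym ([m+n]∸[o+p]≡[m∸o]+[n∸p] r₁≤m₁ r₂≤m₂)) ⟩
    monomial a b (r₁ ℕ.+ r₂) (m₁ ℕ.+ m₂)                       ∎

  monomial-swap : ∀ a b {r m} → r ℕ.≤ m → monomial a b r m ≡ monomial b a (m ℕ.∸ r) m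
  monomial-swap a b {r} {m} r≤m = trans (*-comm (a ^ r) _) (cong (λ e → b ^ (m ℕ.∸ r) * a ^ e) (sym (m∸[m∸n]≡n r≤m)))

  ¬T⇒≡false : ∀ {b} → ¬ T b → b ≡ false
  ¬T⇒≡false {false} _   = refl
  ¬T⇒≡false {true}  ¬tt = contradiction _ ¬tt

  -- δ need only agree pointwise with a·δcoloop + b·δloop: the characters in α are written differently.
  module LoopColoopCharacter {a b : ℚ} {δ : Fun n} (δ≗ : ∀ N → δ N ≡ a * δcoloop N + b * δloop N) where

    δ-vanishes : ∀ {P : SetSys n} → (∣ ground P ∣ ≡ᵇ 1) ≡ false → δ P ≡ 0ℚ
    δ-vanishes {P} ≢1 rewrite δ≗ P | ≢1 = trans (cong₂ _+_ (*-zeroʳ a) (*-zeroʳ b)) (+-identityʳ 0ℚ)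

    δ-singleton : ∀ {P : SetSys n} {ρ} → IsRankOf P ρ → ∣ ground P ∣ ≡ 1 → δ P ≡ monomial a b (ρ (ground P)) 1
    δ-singleton {P} {ρ} isRank ∣G∣≡1 = trans (δ≗ P) (byRank (n≤1⇒n≡0∨n≡1 (subst (ρ G ℕ.≤_) ∣G∣≡1 (bounded ⊆-refl))))
      where
      open IsRankOf isRank
      open RankAxioms axioms
      open RankAxiomsProperties axioms
      G = ground P
      ⊥-basis : ρ G ≡ 0 → Basis P ⊥
      ⊥-basis ρG≡0 = basis⁺ ⊥⊆ (trans ρ⊥≡0 (sym (∣⊥∣≡0 n))) (trans ρ⊥≡0 (sym ρG≡0))
      G-nonbasis : ρ G ≡ 0 → ¬ Basis P G
      G-nonbasis ρG≡0 basisG = 0≢1+n (trans (sym ρG≡0) (trans (proj₁ (proj₂ (basis⁻ basisG))) ∣G∣≡1))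
      ⊥-nonbasis : ρ G ≡ 1 → ¬ Basis P ⊥
      ⊥-nonbasis ρG≡1 basis⊥ = 0≢1+n (trans (sym ρ⊥≡0) (trans (proj₂ (proj₂ (basis⁻ basis⊥))) ρG≡1))
      G-basis : ρ G ≡ 1 → Basis P G
      G-basis ρG≡1 = basis⁺ ⊆-refl (trans ρG≡1 (sym ∣G∣≡1)) refl
      byRank : ρ G ≡ 0 ⊎ ρ G ≡ 1 → a * δcoloop P + b * δloop P ≡ monomial a b (ρ G) 1
      byRank (inj₁ ρG≡0) rewrite ∣G∣≡1 | to T-≡ (⊥-basis ρG≡0) | ¬T⇒≡false (G-nonbasis ρG≡0) | ρG≡0 =
        trans (cong (_+ b * 1ℚ) (*-zeroʳ a)) (trans (+-identityˡ (b * 1ℚ)) (sym (*-identityˡ (b * 1ℚ))))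
      byRank (inj₂ ρG≡1) rewrite ∣G∣≡1 | ¬T⇒≡false (⊥-nonbasis ρG≡1) | to T-≡ (G-basis ρG≡1) | ρG≡1 =
        trans (cong (a * 1ℚ +_) (*-zeroʳ b)) (trans (+-identityʳ (a * 1ℚ)) (sym (*-identityʳ (a * 1ℚ))))

    δ-contract : ∀ {N : SetSys n} {ρ A} → IsRankOf N ρ → A ⊆ ground N →
                 δ (contract N A) ≡ (if ∣ ground N ─ A ∣ ≡ᵇ 1 then monomial a b (ρ (ground N) ℕ.∸ ρ A) 1 else 0ℚ)
    δ-contract {N} {ρ} {A} isRank A⊆G = byCard ∣ ground N ─ A ∣ refl
      where
      ∣G′∣≡∣G─A∣ : ∣ ground (contract N A) ∣ ≡ ∣ ground N ─ A ∣
      ∣G′∣≡∣G─A∣ = cong ∣_∣ ([p─q]∩p≡p─q (ground N) A)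
      byCard : ∀ m → ∣ ground N ─ A ∣ ≡ m →
               δ (contract N A) ≡ (if m ≡ᵇ 1 then monomial a b (ρ (ground N) ℕ.∸ ρ A) 1 else 0ℚ)
      byCard 0             ∣G─A∣≡0 = δ-vanishes (cong (_≡ᵇ 1) (trans ∣G′∣≡∣G─A∣ ∣G─A∣≡0))
      byCard 1             ∣G─A∣≡1 = trans (δ-singleton (contract-isRank isRank A) (trans ∣G′∣≡∣G─A∣ ∣G─A∣≡1))
        (cong (λ r → monomial a b r 1) (contractRank-ground (IsRankOf.axioms isRank) A⊆G))
      byCard (suc (suc m)) ∣G─A∣≡m = δ-vanishes (cong (_≡ᵇ 1) (trans ∣G′∣≡∣G─A∣ ∣G─A∣≡m))

    convPow-formula : ∀ k {N : SetSys n} {ρ} → IsRankOf N ρ →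
                convPow δ k N ≡ (if k ≡ᵇ ∣ ground N ∣ then (k !) × monomial a b (ρ (ground N)) ∣ ground N ∣ else 0ℚ)
    convPow-formula zero {N} {ρ} isRank = empty ∣ ground N ∣ refl
      where
      open RankAxioms (IsRankOf.axioms isRank) using (bounded)
      empty : ∀ m → ∣ ground N ∣ ≡ m →
              (if m ≡ᵇ 0 then 1ℚ else 0ℚ) ≡ (if 0 ≡ᵇ m then 1 × monomial a b (ρ (ground N)) m else 0ℚ)
      empty zero    ∣G∣≡0 rewrite n≤0⇒n≡0 (subst (ρ (ground N) ℕ.≤_) ∣G∣≡0 (bounded ⊆-refl)) = refl
      empty (suc m) _     = refl
    convPow-formula (suc k) {N} {ρ} isRank = begin
      convPow δ (suc k) N
        ≡⟨ ⊛-∑ₛ (convPow δ k) δ N ⟩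
      ∑ₛ (λ A → if A ⊆ᵇ G then convPow δ k (restrict N A) * δ (contract N A) else 0ℚ)
        ≡⟨ ∑ₛ-cong term ⟩
      ∑ₛ (codimIndicator 1 C G)
        ≡⟨ ∑ₛ-codim1 G C ⟩
      ∣ G ∣ × C
        ≡⟨ ∣G∣×C≡ (suc k ≡ᵇ ∣ G ∣) refl ⟩
      (if suc k ≡ᵇ ∣ G ∣ then (suc k !) × X else 0ℚ) ∎
      where
      open IsRankOf isRank
      open RankAxioms axioms
      open RankAxiomsProperties axioms
      open IsRankOfProperties isRank
      G = ground N
      X = monomial a b (ρ G) ∣ G ∣
      C = if suc k ≡ᵇ ∣ G ∣ then (k !) × X else 0ℚ

      ∣G∣×C≡ : ∀ t → (suc k ≡ᵇ ∣ G ∣) ≡ t → ∣ G ∣ × (if t then (k !) × X else 0ℚ) ≡ (if t then (suc k !) × X else 0ℚ)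
      ∣G∣×C≡ false _ = ×-zeroʳ ∣ G ∣
      ∣G∣×C≡ true  t =
        trans (×-assocˡ X ∣ G ∣ (k !)) (cong (λ m → (m ℕ.* (k !)) × X) (sym (≡ᵇ⇒≡ (suc k) ∣ G ∣ (from T-≡ t))))

      coatom : ∀ {A} → A ⊆ G → ∣ G ─ A ∣ ≡ 1 → convPow δ k (restrict N A) * monomial a b (ρ G ℕ.∸ ρ A) 1 ≡ C
      coatom {A} A⊆G ∣G─A∣≡1 = begin
        convPow δ k (restrict N A) * monomial a b (ρ G ℕ.∸ ρ A) 1
          ≡⟨ cong (_* monomial a b (ρ G ℕ.∸ ρ A) 1) (convPow-formula k (restrict-isRank A)) ⟩
        (if k ≡ᵇ ∣ A ∩ G ∣ then (k !) × monomial a b (ρ (A ∩ G)) ∣ A ∩ G ∣ else 0ℚ) * monomial a b (ρ G ℕ.∸ ρ A) 1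
          ≡⟨ cong (λ S → (if k ≡ᵇ ∣ S ∣ then (k !) × monomial a b (ρ S) ∣ S ∣ else 0ℚ) * monomial a b (ρ G ℕ.∸ ρ A) 1)
                  (p⊆q⇒p∩q≡p A⊆G) ⟩
        (if k ≡ᵇ ∣ A ∣ then (k !) × monomial a b (ρ A) ∣ A ∣ else 0ℚ) * monomial a b (ρ G ℕ.∸ ρ A) 1
          ≡⟨ extend (k ≡ᵇ ∣ A ∣) ⟩
        (if k ≡ᵇ ∣ A ∣ then (k !) × monomial a b (ρ G) (suc ∣ A ∣) else 0ℚ)
          ≡⟨ cong (λ m → if suc k ≡ᵇ m then (k !) × monomial a b (ρ G) m else 0ℚ) (sym ∣G∣≡1+∣A∣) ⟩
        C ∎
        where
        ∣G∣≡1+∣A∣ : ∣ G ∣ ≡ suc ∣ A ∣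
        ∣G∣≡1+∣A∣ = trans (p⊆q⇒∣q∣≡∣p∣+∣q─p∣ A⊆G) (trans (cong (∣ A ∣ ℕ.+_) ∣G─A∣≡1) (ℕₚ.+-comm ∣ A ∣ 1))
        monomial-step : monomial a b (ρ A) ∣ A ∣ * monomial a b (ρ G ℕ.∸ ρ A) 1 ≡ monomial a b (ρ G) (suc ∣ A ∣)
        monomial-step = trans (monomial-* a b (bounded (A⊆G)) (subst (ρ G ℕ.∸ ρ A ℕ.≤_) ∣G─A∣≡1 (ρB∸ρA≤∣B─A∣ A⊆G ⊆-refl)))
                              (cong₂ (monomial a b) (m+[n∸m]≡n (monotone A⊆G ⊆-refl)) (ℕₚ.+-comm ∣ A ∣ 1))
        extend : ∀ t → (if t then (k !) × monomial a b (ρ A) ∣ A ∣ else 0ℚ) * monomial a b (ρ G ℕ.∸ ρ A) 1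
                     ≡ (if t then (k !) × monomial a b (ρ G) (suc ∣ A ∣) else 0ℚ)
        extend false = *-zeroˡ (monomial a b (ρ G ℕ.∸ ρ A) 1)
        extend true  = trans (×-assoc-* (k !) _ _) (cong ((k !) ×_) monomial-step)

      summand : ∀ {A} → A ⊆ G → convPow δ k (restrict N A) * δ (contract N A) ≡ (if ∣ G ─ A ∣ ≡ᵇ 1 then C else 0ℚ)
      summand {A} A⊆G with ∣ G ─ A ∣ in ∣G─A∣≡ | δ-contract isRank A⊆G
      ... | 1           | δ≡ = trans (cong (convPow δ k (restrict N A) *_) δ≡) (coatom A⊆G ∣G─A∣≡)
      ... | 0           | δ≡ = trans (cong (convPow δ k (restrict N A) *_) δ≡) (*-zeroʳ (convPow δ k (restrict N A)))
      ... | suc (suc _) | δ≡ = trans (cong (convPow δ k (restrict N A) *_) δ≡) (*-zeroʳ (convPow δ k (restrict N A)))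

      term : ∀ A → (if A ⊆ᵇ G then convPow δ k (restrict N A) * δ (contract N A) else 0ℚ) ≡ codimIndicator 1 C G A
      term A with A ⊆ᵇ G in A⊆ᵇG
      ... | false = refl
      ... | true  = summand (⊆ᵇ⇒⊆ A G (from T-≡ A⊆ᵇG))

    expStar-formula : ∀ {N : SetSys n} {ρ} → IsRankOf N ρ → expStar δ N ≡ monomial a b (ρ (ground N)) ∣ ground N ∣
    expStar-formula {N} {ρ} isRank = begin
      sumℚ (map (λ k → inv! k * convPow δ k N) (upTo (suc n)))
        ≡⟨ sum-map-cong (λ k → cong (inv! k *_) (convPow-formula k isRank)) (upTo (suc n)) ⟩
      sumℚ (map H (upTo (suc n)))
        ≡⟨ cong sumℚ (map-applyUpTo id H (suc n)) ⟩
      sumℚ (applyUpTo H (suc n))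
        ≡⟨ sum-applyUpTo-single H (suc n) (ℕ.s≤s (∣p∣≤n G)) H≗0 ⟩
      H ∣ G ∣
        ≡⟨ H[∣G∣]≡X ⟩
      X ∎
      where
      G = ground N
      X = monomial a b (ρ G) ∣ G ∣
      H : ℕ → ℚ
      H k = inv! k * (if k ≡ᵇ ∣ G ∣ then (k !) × X else 0ℚ)
      H≗0 : ∀ k → k ≢ ∣ G ∣ → H k ≡ 0ℚ
      H≗0 k k≢∣G∣ with k ≡ᵇ ∣ G ∣ in k≡ᵇ∣G∣
      ... | true  = contradiction (≡ᵇ⇒≡ k ∣ G ∣ (from T-≡ k≡ᵇ∣G∣)) k≢∣G∣
      ... | false = *-zeroʳ (inv! k)
      H[∣G∣]≡X : H ∣ G ∣ ≡ X
      H[∣G∣]≡X rewrite to T-≡ (≡⇒≡ᵇ ∣ G ∣ ∣ G ∣ refl) = begin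
        inv! m * ((m !) × X)            ≡⟨ cong (λ y → inv! m * ((m !) × y)) (sym (*-identityˡ X)) ⟩
        inv! m * ((m !) × (1ℚ * X))     ≡⟨ cong (inv! m *_) (sym (×-assoc-* (m !) 1ℚ X)) ⟩
        inv! m * ((m !) × 1ℚ * X)       ≡⟨ sym (*-assoc (inv! m) _ X) ⟩
        inv! m * ((m !) × 1ℚ) * X       ≡⟨ cong (_* X) (inv!*k!≡1 m) ⟩
        1ℚ * X                          ≡⟨ *-identityˡ X ⟩
        X                               ∎
        where m = ∣ G ∣

  αTerm : ℚ → ℚ → ℚ → (Subset n → ℕ) → Subset n → Subset n → ℚ
  αTerm x y s ρ G A = monomial s (s * (y - 1ℚ)) (ρ A) ∣ A ∣ * monomial (s * (x - 1ℚ)) s (ρ G ℕ.∸ ρ A) ∣ G ─ A ∣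

  α-expansion : ∀ x y s {N : SetSys n} {ρ} → IsRankOf N ρ →
                α x y s N ≡ ∑ₛ (λ A → if A ⊆ᵇ ground N then αTerm x y s ρ (ground N) A else 0ℚ)
  α-expansion x y s {N} {ρ} isRank = trans (⊛-∑ₛ (expStar δ₁) (expStar δ₂) N) (∑ₛ-cong term)
    where
    open IsRankOfProperties isRank using (restrict-isRank)
    G = ground N
    Y = s * (y - 1ℚ)
    X′ = s * (x - 1ℚ)
    δ₁ δ₂ : Fun n
    δ₁ P = s * (δcoloop P + (y - 1ℚ) * δloop P)
    δ₂ P = s * ((x - 1ℚ) * δcoloop P + δloop P)
    δ₁≗ : ∀ P → δ₁ P ≡ s * δcoloop P + Y * δloop P
    δ₁≗ P = trans (*-distribˡ-+ s _ _) (cong (s * δcoloop P +_) (sym (*-assoc s (y - 1ℚ) _)))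
    δ₂≗ : ∀ P → δ₂ P ≡ X′ * δcoloop P + s * δloop P
    δ₂≗ P = trans (*-distribˡ-+ s _ _) (cong (_+ s * δloop P) (sym (*-assoc s (x - 1ℚ) _)))
    term : ∀ A → (if A ⊆ᵇ G then expStar δ₁ (restrict N A) * expStar δ₂ (contract N A) else 0ℚ)
               ≡ (if A ⊆ᵇ G then αTerm x y s ρ G A else 0ℚ)
    term A with A ⊆ᵇ G in A⊆ᵇG
    ... | false = refl
    ... | true  = cong₂ _*_
      (trans (LoopColoopCharacter.expStar-formula δ₁≗ (restrict-isRank A))
             (cong (λ S → monomial s Y (ρ S) ∣ S ∣) (p⊆q⇒p∩q≡p A⊆G)))
      (trans (LoopColoopCharacter.expStar-formula δ₂≗ (contract-isRank isRank A))
             (cong₂ (monomial X′ s) (contractRank-ground (IsRankOf.axioms isRank) A⊆G) (cong ∣_∣ ([p─q]∩p≡p─q G A))))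
      where A⊆G = ⊆ᵇ⇒⊆ A G (from T-≡ A⊆ᵇG)

  αTerm-dual : ∀ x y s {G A : Subset n} {ρ} → RankAxioms G ρ → A ⊆ G →
               αTerm x y s ρ G A ≡ αTerm y x s (dualRank G ρ) G (G ─ A)
  αTerm-dual x y s {G} {A} {ρ} ax A⊆G = begin
    monomial s Y (ρ A) ∣ A ∣ * monomial X′ s (ρ G ℕ.∸ ρ A) ∣ G ─ A ∣
      ≡⟨ cong₂ _*_ (monomial-swap s Y (bounded A⊆G)) (monomial-swap X′ s (ρB∸ρA≤∣B─A∣ A⊆G ⊆-refl)) ⟩
    monomial Y s (∣ A ∣ ℕ.∸ ρ A) ∣ A ∣ * monomial s X′ (∣ G ─ A ∣ ℕ.∸ (ρ G ℕ.∸ ρ A)) ∣ G ─ A ∣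
      ≡⟨ *-comm (monomial Y s (∣ A ∣ ℕ.∸ ρ A) ∣ A ∣) _ ⟩
    monomial s X′ (∣ G ─ A ∣ ℕ.∸ (ρ G ℕ.∸ ρ A)) ∣ G ─ A ∣ * monomial Y s (∣ A ∣ ℕ.∸ ρ A) ∣ A ∣
      ≡⟨ sym (cong₂ _*_ (cong (λ r → monomial s X′ r ∣ G ─ A ∣) ρ*[G─A]≡)
                        (cong₂ (monomial Y s) (ρ*[G]∸ρ*[G─A] A⊆G) (cong ∣_∣ (p⊆q⇒q─[q─p]≡p A⊆G)))) ⟩
    αTerm y x s ρ* G (G ─ A) ∎
    where
    open RankAxioms ax
    open RankAxiomsProperties ax
    open DualRankProperties ax
    Y = s * (y - 1ℚ)
    X′ = s * (x - 1ℚ)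
    ρ* = dualRank G ρ
    ρ*[G─A]≡ : ρ* (G ─ A) ≡ ∣ G ─ A ∣ ℕ.∸ (ρ G ℕ.∸ ρ A)
    ρ*[G─A]≡ = trans (sym (m+n∸n≡m _ (ρ G ℕ.∸ ρ A))) (cong (ℕ._∸ (ρ G ℕ.∸ ρ A)) (ρ*[G─A]+[ρG∸ρA] A⊆G))

  ∑ₛ-if-⊆ᵇ⊤ : ∀ (h : Subset n → ℚ) → ∑ₛ (λ A → if A ⊆ᵇ ⊤ then h A else 0ℚ) ≡ ∑ₛ h
  ∑ₛ-if-⊆ᵇ⊤ h = ∑ₛ-cong (λ A → cong (if_then h A else 0ℚ) (to T-≡ (⊆⇒⊆ᵇ A ⊤ ⊆⊤)))

open RankFunctions
open Expansion

mainTheorem4 : ∀ (n : ℕ) (M : Matroid n) (x y s : ℚ) →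
    α x y s (toSys M) ≡ α y x s (dual (toSys M))
mainTheorem4 n M x y s = begin
  α x y s (toSys M)                                    ≡⟨ α-expansion x y s rank-isRank ⟩
  ∑ₛ (λ A → if A ⊆ᵇ ⊤ then αTerm x y s rank ⊤ A else 0ℚ) ≡⟨ ∑ₛ-if-⊆ᵇ⊤ (αTerm x y s rank ⊤) ⟩
  ∑ₛ (αTerm x y s rank ⊤)                              ≡⟨ ∑ₛ-cong (λ A → αTerm-dual x y s {A = A} rank-axioms ⊆⊤) ⟩
  ∑ₛ (αTerm y x s rank* ⊤ ∘ (⊤ ─_))                    ≡⟨ ∑ₛ-cong (cong (αTerm y x s rank* ⊤) ∘ ⊤─p≡∁p) ⟩
  ∑ₛ (αTerm y x s rank* ⊤ ∘ ∁)                         ≡⟨ sym (∑ₛ-∁ (αTerm y x s rank* ⊤)) ⟩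
  ∑ₛ (αTerm y x s rank* ⊤)                             ≡⟨ sym (∑ₛ-if-⊆ᵇ⊤ (αTerm y x s rank* ⊤)) ⟩
  ∑ₛ (λ A → if A ⊆ᵇ ⊤ then αTerm y x s rank* ⊤ A else 0ℚ) ≡⟨ sym (α-expansion y x s (dual-isRank rank-isRank)) ⟩
  α y x s (dual (toSys M))                             ∎
  where
  open ≡-Reasoning
  open MatroidRank M
  rank* = dualRank ⊤ rank
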